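{- (i) Let $k\in\{1,2\}$, let $r_1,\dots,r_k$ and $s_1,\dots,s_k$ be positive integers and $s_{k+1}$ a nonnegative integer such that $\sum_{i=1}^t s_i<\sum_{i=1}^t r_i<\sum_{i=1}^{t+1}s_i$ for all $1\leq t<k$, and $n=r_1+\dots+r_k=s_1+\dots+s_{k+1}$. Define $$\alpha_{i,i}=\frac{s_1+\cdots+s_i-r_1-\cdots-r_{i-1}}{r_i s_i},\qquad \alpha_{i,i+1}=\frac{r_1+\cdots+r_i-s_1-\cdots-s_i}{r_i s_{i+1}},$$ assumed positive for each nonvoid block, and let $X^{(\bar r,\bar s)}$ be the $n\times n$ block matrix whose rows are partitioned into consecutive blocks of sizes $r_1,\dots,r_k$ and whose columns are partitioned into consecutive blocks of sizes $s_1,\dots,s_{k+1}$, where the $(i,i)$ block is $\alpha_{i,i}\mathbb{1}_{r_i\times s_i}$, the $(i,i+1)$ block is $\alpha_{i,i+1}\mathbb{1}_{r_i\times s_{i+1}}$ (void if $s_{k+1}=0$ and $i=k$), and all other blocks are zero. Then $X^{(\bar r,\bar s)}$ is an Erdős matrix. In particular, for integers $0<s<r<n$, the matrix $$X^{(r,s,n)}=\begin{pmatrix}\frac1r\mathbb{1}_{r\times s} & \frac{r-s}{r(n-s)}\mathbb{1}_{r\times(n-s)}\\ \mathbf{0}_{(n-r)\times s} & \frac{1}{n-s}\mathbb{1}_{(n-r)\times(n-s)}\end{pmatrix}$$ is an Erdős matrix. (ii) Let $n=2p$, let $\alpha_1,\alpha_2,\alpha_3,\alpha_4\in\{1,\dots,p\}$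 with $\alpha_1+\alpha_4=\alpha_2+\alpha_3$, and let $A_i$ be a $p\times p$ $0/1$ matrix with exactly $\alpha_i$ ones in each row and each column ($i=1,\dots,4$). Then $$X^{\bar\alpha}=\frac{1}{\alpha_1\alpha_4+\alpha_2\alpha_3}\begin{pmatrix}\alpha_4A_1 & \alpha_3A_2\\ \alpha_2A_3 & \alpha_1A_4\end{pmatrix}$$ is an Erdős matrix.
   Context: $\mathbb{1}_{l\times m}$ denotes the $l\times m$ all-ones matrix and $\mathbf{0}$ a zero block. A real $n\times n$ matrix is bistochastic if all entries lie in $[0,1]$ and every row and column sum equals $1$. Let $P_n$ be the set of $n\times n$ permutation matrices; for $\sigma\in P_n$, $\operatorname{tr}_\sigma(M)=\operatorname{tr}(\sigma^TM)$ and $\operatorname{maxtrace}(M)=\max_{\sigma\in P_n}\operatorname{tr}_\sigma(M)$. A bistochastic matrix $E$ is an Erdős matrix if $\operatorname{maxtrace}(E)=\sum_{i,j}E_{i,j}^2$. -}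

module Defs where

open import Data.Nat as ℕ using (ℕ; zero; suc; _<ᵇ_; _≡ᵇ_)
open import Data.Integer as ℤ using (ℤ; +_)
open import Data.Rational using (ℚ; 0ℚ; 1ℚ; _+_; _*_; _≤_; _/_)
open import Data.Fin using (Fin; zero; suc; toℕ; splitAt)
open import Data.Fin.Permutation using (Permutation′; _⟨$⟩ʳ_)
open import Data.Bool using (Bool; true; false; if_then_else_)
open import Data.List using (List; []; _∷_)
open import Data.Product using (_×_; ∃)
open import Data.Sum using (inj₁; inj₂)
open import Relation.Binary.PropositionalEquality using (_≡_)

-- real (here: rational) n×n matrices
Matrix : ℕ → Set
Matrix n = Fin n → Fin n → ℚ

∑ : ∀ {n} → (Fin n → ℚ) → ℚ
∑ {zero}  f = 0ℚ
∑ {suc n} f = f zero + ∑ (λ i → f (suc i))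

∑ℕ : ∀ {n} → (Fin n → ℕ) → ℕ
∑ℕ {zero}  f = 0
∑ℕ {suc n} f = f zero ℕ.+ ∑ℕ (λ i → f (suc i))

Bistochastic : ∀ {n} → Matrix n → Set
Bistochastic {n} M =
  (∀ i j → (0ℚ ≤ M i j) × (M i j ≤ 1ℚ)) ×
  (∀ i → ∑ (λ j → M i j) ≡ 1ℚ) ×
  (∀ j → ∑ (λ i → M i j) ≡ 1ℚ)

-- tr_σ(M) = tr(σᵀ M) = Σ_i M_{i,σ(i)}  (σ a permutation of Fin n)
tr[_] : ∀ {n} → Permutation′ n → Matrix n → ℚ
tr[ σ ] M = ∑ (λ i → M i (σ ⟨$⟩ʳ i))

-- "v = maxtrace(M)": v is the maximum of tr_σ(M) over σ ∈ P_n
IsMaxtrace : ∀ {n} → Matrix n → ℚ → Set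
IsMaxtrace {n} M v = (∃ λ (σ : Permutation′ n) → tr[ σ ] M ≡ v) ×
                     (∀ (σ : Permutation′ n) → tr[ σ ] M ≤ v)

sumSq : ∀ {n} → Matrix n → ℚ
sumSq M = ∑ (λ i → ∑ (λ j → M i j * M i j))

Erdos : ∀ {n} → Matrix n → Set
Erdos M = Bistochastic M × IsMaxtrace M (sumSq M)

-- p / d as a rational, with the (never used) convention p / 0 = 0
frac : ℤ → ℕ → ℚ
frac p zero    = 0ℚ
frac p (suc d) = p / suc d

-- a-th entry (0-based), 0 out of range
at : List ℕ → ℕ → ℕ
at []       _       = 0
at (m ∷ ms) zero    = m
at (m ∷ ms) (suc a) = at ms a

len : List ℕ → ℕ
len []       = 0
len (_ ∷ ms) = suc (len ms)

psum : List ℕ → ℕ → ℕ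
psum []       _       = 0
psum (m ∷ ms) zero    = 0
psum (m ∷ ms) (suc t) = m ℕ.+ psum ms t

total : List ℕ → ℕ
total []       = 0
total (m ∷ ms) = m ℕ.+ total ms

-- index (0-based) of the block of consecutive blocks of the given sizes containing x
blockOf : List ℕ → ℕ → ℕ
blockOf []       x = 0
blockOf (m ∷ ms) x = if x <ᵇ m then 0 else suc (blockOf ms (x ℕ.∸ m))

-- X^{(r̄,s̄)}, 0-based: row block a, column block b.
-- block (a,a)   : α_{a,a}   = (s_1+…+s_{a+1} − r_1−…−r_a) / (r_{a+1} s_{a+1})   (1-based indices)
-- block (a,a+1) : α_{a,a+1} = (r_1+…+r_{a+1} − s_1−…−s_{a+1}) / (r_{a+1} s_{a+2})
Xblock : (r s : List ℕ) → ℕ → ℕ → ℚ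
Xblock r s x y with blockOf r x | blockOf s y
... | a | b =
  if b ≡ᵇ a then frac (+ psum s (suc a) ℤ.- + psum r a) (at r a ℕ.* at s a)
  else if b ≡ᵇ suc a then frac (+ psum r (suc a) ℤ.- + psum s (suc a)) (at r a ℕ.* at s (suc a))
  else 0ℚ

Xrs : (r s : List ℕ) (n : ℕ) → Matrix n
Xrs r s n i j = Xblock r s (toℕ i) (toℕ j)

Admissible : (r s : List ℕ) (n : ℕ) → Set
Admissible r s n =
  (len r ≡ 1 Data.Sum.⊎ len r ≡ 2) ×
  len s ≡ suc (len r) ×
  (∀ i → i ℕ.< len r → 0 ℕ.< at r i) ×
  (∀ i → i ℕ.< len r → 0 ℕ.< at s i) ×
  (∀ t → 1 ℕ.≤ t → t ℕ.< len r →
     (psum s t ℕ.< psum r t) × (psum r t ℕ.< psum s (suc t))) ×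
  total r ≡ n × total s ≡ n

Xrsn : (r s n : ℕ) → Matrix n
Xrsn r s n i j with toℕ i ℕ.<ᵇ r | toℕ j ℕ.<ᵇ s
... | true  | true  = frac (+ 1) r
... | true  | false = frac (+ r ℤ.- + s) (r ℕ.* (n ℕ.∸ s))
... | false | true  = 0ℚ
... | false | false = frac (+ 1) (n ℕ.∸ s)

BoolMatrix : ℕ → Set
BoolMatrix p = Fin p → Fin p → Bool

ind : Bool → ℕ
ind true  = 1
ind false = 0

Regular : ∀ {p} → BoolMatrix p → ℕ → Set
Regular {p} A α = (∀ i → ∑ℕ (λ j → ind (A i j)) ≡ α) ×
                  (∀ j → ∑ℕ (λ i → ind (A i j)) ≡ α)

Xalpha : (p a₁ a₂ a₃ a₄ : ℕ) (A₁ A₂ A₃ A₄ : BoolMatrix p) → Matrix (p ℕ.+ p)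
Xalpha p a₁ a₂ a₃ a₄ A₁ A₂ A₃ A₄ i j with splitAt p i | splitAt p j
... | inj₁ i′ | inj₁ j′ = frac (+ (a₄ ℕ.* ind (A₁ i′ j′))) D
  where D = a₁ ℕ.* a₄ ℕ.+ a₂ ℕ.* a₃
... | inj₁ i′ | inj₂ j′ = frac (+ (a₃ ℕ.* ind (A₂ i′ j′))) D
  where D = a₁ ℕ.* a₄ ℕ.+ a₂ ℕ.* a₃
... | inj₂ i′ | inj₁ j′ = frac (+ (a₂ ℕ.* ind (A₃ i′ j′))) D
  where D = a₁ ℕ.* a₄ ℕ.+ a₂ ℕ.* a₃
... | inj₂ i′ | inj₂ j′ = frac (+ (a₁ ℕ.* ind (A₄ i′ j′))) D
  where D = a₁ ℕ.* a₄ ℕ.+ a₂ ℕ.* a₃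

{-# OPTIONS --safe #-}

-- Each matrix X is certified by potentials u, v with u i + v j ≥ 0 and every entry of X either 0
-- or equal to u i + v j (complementary slackness for the assignment problem).  Then
-- X i j ² = (u i + v j) X i j, so bistochasticity gives Σ X i j ² = Σ u + Σ v; every trace tr_σ X is
-- at most Σ u + Σ v; and the bound is attained by any permutation inside the support of X, which
-- exists by Hall's theorem because the mass ∣S∣ of a set S of rows lies in the columns adjacent to S.
-- For X^(r̄,s̄) the potentials are constant on blocks; X^(r,s,n) is X^(r̄,s̄) for r̄ = (r, n − r),
-- s̄ = (s, n − s, 0); for X^ᾱ they are constant on quadrants, solvable because α₁ + α₄ = α₂ + α₃.

module Submission where

open import Defs
open import Data.Nat using (ℕ; zero; suc; _<_; _≤_; _+_; _∸_; _<ᵇ_; _≡ᵇ_; z≤n; s≤s)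
open import Data.List using (List; []; _∷_)
open import Data.Product using (_×_; Σ; ∃; _,_; proj₁; proj₂; map₁)
open import Relation.Binary.PropositionalEquality
  using (_≡_; refl; sym; trans; cong; cong₂; subst; subst₂; module ≡-Reasoning)

open import Algebra.Bundles using (CommutativeRing)
open import Data.Bool using (Bool; true; false; T; if_then_else_)
open import Data.Bool.Properties using (T-≡)
open import Data.Empty using (⊥-elim)
open import Data.Fin as Fin using (Fin; zero; suc; toℕ; splitAt; _↑ˡ_; _↑ʳ_; punchOut)
import Data.Fin.Properties as Fin
open import Data.Fin.Permutation using (Permutation′; _⟨$⟩ʳ_)
open import Data.Fin.Subset
  using (Subset; _∈_; _⊆_; ⊤; ⁅_⁆; _∩_; _∪_; _─_; _-_; ∣_∣; Nonempty; Empty; inside; outside)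
open import Data.Fin.Subset.Properties
  using (_∈?_; _⊆?_; nonempty?; anySubset?; ∈⊤; ∣p∣≤n; ∣⊥∣≡0; Empty-unique; x∈⁅x⁆; x∈⁅y⁆⇒x≡y; ∣⁅x⁆∣≡1;
         ⊆-trans; p⊆q⇒∣p∣≤∣q∣; x∈p∩q⁺; x∈p∩q⁻; p∩q⊆p; x∈p∪q⁺; x∈p∪q⁻; x∈p∧x∉q⇒x∈p─q; p─q⊆p;
         ∣p─q∣≤∣p∣; p∩q≢∅⇒∣p─q∣<∣p∣; x∈p∧x≢y⇒x∈p-y; x∈p⇒∣p-x∣<∣p∣)
import Data.Integer as ℤ
import Data.Integer.Properties as ℤ
import Data.Nat as ℕ
import Data.Nat.Properties as ℕ
open import Data.Nat.Solver using (module +-*-Solver)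
open import Data.Rational as ℚ using (ℚ; 0ℚ; 1ℚ)
import Data.Rational.Properties as ℚ
import Data.Rational.Solver as ℚ-Solver
import Data.Rational.Unnormalised as ℚᵘ
import Data.Rational.Unnormalised.Properties as ℚᵘ
open import Data.Sum using (_⊎_; inj₁; inj₂)
import Data.Sum as Sum
open import Data.Vec using ([]; _∷_; lookup; tabulate; here; there)
import Data.Vec.Properties as Vec
open import Function using (_∘_)
open import Function.Bundles using (Equivalence; mk↔ₛ′)
open import Function.Definitions using (Injective)
open import Relation.Nullary using (¬_; ¬?; Dec; yes; no; does; proof; contradiction)
open import Relation.Nullary.Decidable using (_×-dec_; dec-true)
open import Relation.Nullary.Reflects using (Reflects; invert)
import Algebra.Properties.Semiring.Sum as SemiringSum

module ℚΣ = SemiringSum (CommutativeRing.semiring ℚ.+-*-commutativeRing)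
open import Algebra.Definitions.RawMonoid ℚ.+-0-rawMonoid using () renaming (_×_ to _·_)
open +-*-Solver using (solve; _:+_; _:*_; _:=_; con)

m<n⇒∃[o>0]n≡m+o : ∀ {m n} → m < n → ∃ λ o → 0 < o × n ≡ m + o
m<n⇒∃[o>0]n≡m+o {m} m<n with ℕ.m≤n⇒∃[o]m+o≡n m<n
... | o , 1+m+o≡n = suc o , s≤s z≤n , trans (sym 1+m+o≡n) (sym (ℕ.+-suc m o))

<ᵇ-false⇒≥ : ∀ {x m} → (x <ᵇ m) ≡ false → m ≤ x
<ᵇ-false⇒≥ {x} {m} x≮ᵇm = ℕ.≮⇒≥ (λ x<m → subst T x≮ᵇm (ℕ.<⇒<ᵇ x<m))

∸-<ᵇ : ∀ {x m k} → m ≤ x → x < m + k → (x ∸ m <ᵇ k) ≡ true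
∸-<ᵇ {x} {m} {k} m≤x x<m+k = Equivalence.to T-≡
  (ℕ.<⇒<ᵇ (ℕ.+-cancelˡ-< m (x ∸ m) k (subst (_< m + k) (sym (ℕ.m+[n∸m]≡n m≤x)) x<m+k)))

infixl 7 _÷_

-- m ÷ 0 = 0 (inherited from frac); this junk value lets ·-÷ hold for every d and ·-self-÷ for t = 0.
_÷_ : ℕ → ℕ → ℚ
m ÷ d = frac (ℤ.+ m) d

private
  toℚᵘ-÷ : ∀ m d → ℚ.toℚᵘ (m ÷ suc d) ℚᵘ.≃ ℚᵘ.mkℚᵘ (ℤ.+ m) d
  toℚᵘ-÷ m d = ℚ.toℚᵘ-fromℚᵘ (ℚᵘ.mkℚᵘ (ℤ.+ m) d)

÷-nonneg : ∀ m d → 0ℚ ℚ.≤ m ÷ d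
÷-nonneg m zero    = ℚ.≤-refl
÷-nonneg m (suc d) = ℚ.nonNegative⁻¹ _ {{ℚ.normalize-nonNeg m (suc d)}}

÷-cross : ∀ {m k d e} → 0 < d → 0 < e → m ℕ.* e ≡ k ℕ.* d → m ÷ d ≡ k ÷ e
÷-cross {m} {k} {suc d} {suc e} _ _ me≡kd = ℚ.toℚᵘ-injective (begin
  ℚ.toℚᵘ (m ÷ suc d)     ≈⟨ toℚᵘ-÷ m d ⟩
  ℚᵘ.mkℚᵘ (ℤ.+ m) d      ≈⟨ ℚᵘ.*≡* (trans (sym (ℤ.pos-* m (suc e))) (trans (cong ℤ.+_ me≡kd) (ℤ.pos-* k (suc d))))
                         ⟩
  ℚᵘ.mkℚᵘ (ℤ.+ k) e      ≈⟨ toℚᵘ-÷ k e ⟨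
  ℚ.toℚᵘ (k ÷ suc e)     ∎)
  where open import Relation.Binary.Reasoning.Setoid ℚᵘ.≃-setoid

÷-reflects-≤ : ∀ {m k d e} → 0 < d → 0 < e → m ÷ d ℚ.≤ k ÷ e → m ℕ.* e ≤ k ℕ.* d
÷-reflects-≤ {m} {k} {suc d} {suc e} _ _ m/d≤k/e =
  ℤ.drop‿+≤+ (subst₂ ℤ._≤_ (sym (ℤ.pos-* m (suc e))) (sym (ℤ.pos-* k (suc d)))
    (ℚᵘ.drop-*≤* (ℚᵘ.≤-respˡ-≃ (toℚᵘ-÷ m d) (ℚᵘ.≤-respʳ-≃ (toℚᵘ-÷ k e) (ℚ.toℚᵘ-mono-≤ m/d≤k/e)))))

÷-+ : ∀ {m k d e} → 0 < d → 0 < e → m ÷ d ℚ.+ k ÷ e ≡ (m ℕ.* e + k ℕ.* d) ÷ (d ℕ.* e)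
÷-+ {m} {k} {suc d} {suc e} _ _ = ℚ.toℚᵘ-injective (begin
  ℚ.toℚᵘ (m ÷ suc d ℚ.+ k ÷ suc e)               ≈⟨ ℚ.toℚᵘ-homo-+ (m ÷ suc d) (k ÷ suc e) ⟩
  ℚ.toℚᵘ (m ÷ suc d) ℚᵘ.+ ℚ.toℚᵘ (k ÷ suc e)    ≈⟨ ℚᵘ.+-cong (toℚᵘ-÷ m d) (toℚᵘ-÷ k e) ⟩
  ℚᵘ.mkℚᵘ (ℤ.+ m) d ℚᵘ.+ ℚᵘ.mkℚᵘ (ℤ.+ k) e      ≡⟨ cong (λ z → ℚᵘ.mkℚᵘ z (e + d ℕ.* suc e)) numerator ⟩
  ℚᵘ.mkℚᵘ (ℤ.+ (m ℕ.* suc e + k ℕ.* suc d)) (e + d ℕ.* suc e) ≈⟨ toℚᵘ-÷ _ _ ⟨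
  ℚ.toℚᵘ ((m ℕ.* suc e + k ℕ.* suc d) ÷ (suc d ℕ.* suc e)) ∎)
  where
  open import Relation.Binary.Reasoning.Setoid ℚᵘ.≃-setoid
  numerator : ℤ.+ m ℤ.* ℤ.+ suc e ℤ.+ ℤ.+ k ℤ.* ℤ.+ suc d ≡ ℤ.+ (m ℕ.* suc e + k ℕ.* suc d)
  numerator = trans (cong₂ ℤ._+_ (sym (ℤ.pos-* m (suc e))) (sym (ℤ.pos-* k (suc d))))
                    (sym (ℤ.pos-+ (m ℕ.* suc e) (k ℕ.* suc d)))

÷-+-same : ∀ {m k d} → 0 < d → m ÷ d ℚ.+ k ÷ d ≡ (m + k) ÷ d
÷-+-same {m} {k} {d} 0<d = trans (÷-+ 0<d 0<d) (÷-cross (ℕ.*-mono-≤ 0<d 0<d) 0<d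
  (solve 3 (λ m k d → (m :* d :+ k :* d) :* d := (m :+ k) :* (d :* d)) refl m k d))

÷-zero : ∀ d → 0 ÷ d ≡ 0ℚ
÷-zero zero    = refl
÷-zero (suc d) = ÷-cross {0} {0} {suc d} {1} (s≤s z≤n) (s≤s z≤n) refl

÷-self : ∀ {d} → 0 < d → d ÷ d ≡ 1ℚ
÷-self {d} 0<d = ÷-cross {d} {1} {d} {1} 0<d (s≤s z≤n) (trans (ℕ.*-identityʳ d) (sym (ℕ.*-identityˡ d)))

·-zeroʳ : ∀ k → k · 0ℚ ≡ 0ℚ
·-zeroʳ zero    = refl
·-zeroʳ (suc k) = trans (ℚ.+-identityˡ (k · 0ℚ)) (·-zeroʳ k)

·-÷ : ∀ k m d → k · (m ÷ d) ≡ (k ℕ.* m) ÷ d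
·-÷ k       m zero    = ·-zeroʳ k
·-÷ zero    m (suc d) = sym (÷-zero (suc d))
·-÷ (suc k) m (suc d) = trans (cong (m ÷ suc d ℚ.+_) (·-÷ k m (suc d))) (÷-+-same {m} {k ℕ.* m} (s≤s z≤n))

frac-diff : ∀ {a b c} d → a ≡ b + c → frac (ℤ.+ a ℤ.- ℤ.+ b) d ≡ c ÷ d
frac-diff {a} {b} {c} d a≡b+c = cong (λ z → frac z d) (begin
  ℤ.+ a ℤ.- ℤ.+ b  ≡⟨ ℤ.[+m]-[+n]≡m⊖n a b ⟩
  a ℤ.⊖ b          ≡⟨ ℤ.⊖-≥ (subst (b ≤_) (sym a≡b+c) (ℕ.m≤m+n b c)) ⟩
  ℤ.+ (a ∸ b)      ≡⟨ cong ℤ.+_ (trans (cong (_∸ b) a≡b+c) (ℕ.m+n∸m≡n b c)) ⟩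
  ℤ.+ c            ∎)
  where open ≡-Reasoning

÷-cancel : ∀ {m d} → 0 < m → 0 < d → m ÷ (d ℕ.* m) ≡ 1 ÷ d
÷-cancel {m} {d} 0<m 0<d = ÷-cross (ℕ.*-mono-≤ 0<d 0<m) 0<d
  (solve 2 (λ m d → m :* d := con 1 :* (d :* m)) refl m d)

·-÷-cancelˡ : ∀ {m d} k → 0 < m → 0 < d → m · (k ÷ (m ℕ.* d)) ≡ k ÷ d
·-÷-cancelˡ {m} {d} k 0<m 0<d = trans (·-÷ m k (m ℕ.* d)) (÷-cross (ℕ.*-mono-≤ 0<m 0<d) 0<d
  (solve 3 (λ m d k → m :* k :* d := k :* (m :* d)) refl m d k))

·-÷-cancelʳ : ∀ {m d} k → 0 < m → 0 < d → m · (k ÷ (d ℕ.* m)) ≡ k ÷ d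
·-÷-cancelʳ {m} {d} k 0<m 0<d = trans (·-÷ m k (d ℕ.* m)) (÷-cross (ℕ.*-mono-≤ 0<d 0<m) 0<d
  (solve 3 (λ m d k → m :* k :* d := k :* (d :* m)) refl m d k))

·-self-÷ : ∀ t {d} → 0 < d → t · (t ÷ (d ℕ.* t)) ≡ t ÷ d
·-self-÷ zero    {d} 0<d = sym (÷-zero d)
·-self-÷ (suc t) {d} 0<d = ·-÷-cancelʳ (suc t) (s≤s z≤n) 0<d

*-unitʳ : ∀ c {s} → s ≡ 1ℚ → c ℚ.* s ≡ c
*-unitʳ c refl = ℚ.*-identityʳ c

∑≡sum : ∀ {n} (f : Fin n → ℚ) → ∑ f ≡ ℚΣ.sum f
∑≡sum {zero}  f = refl
∑≡sum {suc n} f = cong (f zero ℚ.+_) (∑≡sum (f ∘ suc))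

∑-cong : ∀ {n} {f g : Fin n → ℚ} → (∀ i → f i ≡ g i) → ∑ f ≡ ∑ g
∑-cong {zero}  f≗g = refl
∑-cong {suc n} f≗g = cong₂ ℚ._+_ (f≗g zero) (∑-cong (f≗g ∘ suc))

∑-mono-≤ : ∀ {n} {f g : Fin n → ℚ} → (∀ i → f i ℚ.≤ g i) → ∑ f ℚ.≤ ∑ g
∑-mono-≤ {zero}  f≤g = ℚ.≤-refl
∑-mono-≤ {suc n} f≤g = ℚ.+-mono-≤ (f≤g zero) (∑-mono-≤ (f≤g ∘ suc))

∑-distrib-+ : ∀ {n} (f g : Fin n → ℚ) → ∑ (λ i → f i ℚ.+ g i) ≡ ∑ f ℚ.+ ∑ g
∑-distrib-+ f g = begin
  ∑ (λ i → f i ℚ.+ g i)          ≡⟨ ∑≡sum (λ i → f i ℚ.+ g i) ⟩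
  ℚΣ.sum (λ i → f i ℚ.+ g i)     ≡⟨ ℚΣ.∑-distrib-+ f g ⟩
  ℚΣ.sum f ℚ.+ ℚΣ.sum g          ≡⟨ cong₂ ℚ._+_ (∑≡sum f) (∑≡sum g) ⟨
  ∑ f ℚ.+ ∑ g                    ∎
  where open ≡-Reasoning

∑-*ˡ : ∀ {n} c (f : Fin n → ℚ) → ∑ (λ i → c ℚ.* f i) ≡ c ℚ.* ∑ f
∑-*ˡ c f = begin
  ∑ (λ i → c ℚ.* f i)        ≡⟨ ∑≡sum (λ i → c ℚ.* f i) ⟩
  ℚΣ.sum (λ i → c ℚ.* f i)   ≡⟨ ℚΣ.*-distribˡ-sum c f ⟨
  c ℚ.* ℚΣ.sum f             ≡⟨ cong (c ℚ.*_) (∑≡sum f) ⟨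
  c ℚ.* ∑ f                  ∎
  where open ≡-Reasoning

∑-comm : ∀ {m n} (f : Fin m → Fin n → ℚ) → ∑ (λ i → ∑ (f i)) ≡ ∑ (λ j → ∑ (λ i → f i j))
∑-comm f = begin
  ∑ (λ i → ∑ (f i))                    ≡⟨ ∑-cong (λ i → ∑≡sum (f i)) ⟩
  ∑ (λ i → ℚΣ.sum (f i))               ≡⟨ ∑≡sum (λ i → ℚΣ.sum (f i)) ⟩
  ℚΣ.sum (λ i → ℚΣ.sum (f i))          ≡⟨ ℚΣ.∑-comm f ⟩
  ℚΣ.sum (λ j → ℚΣ.sum (λ i → f i j))  ≡⟨ ∑≡sum (λ j → ℚΣ.sum (λ i → f i j)) ⟨
  ∑ (λ j → ℚΣ.sum (λ i → f i j))       ≡⟨ ∑-cong (λ j → ∑≡sum (λ i → f i j)) ⟨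
  ∑ (λ j → ∑ (λ i → f i j))            ∎
  where open ≡-Reasoning

∑-permute : ∀ {n} (f : Fin n → ℚ) (σ : Permutation′ n) → ∑ (λ i → f (σ ⟨$⟩ʳ i)) ≡ ∑ f
∑-permute f σ = begin
  ∑ (λ i → f (σ ⟨$⟩ʳ i))       ≡⟨ ∑≡sum (λ i → f (σ ⟨$⟩ʳ i)) ⟩
  ℚΣ.sum (λ i → f (σ ⟨$⟩ʳ i))  ≡⟨ ℚΣ.sum-permute f σ ⟨
  ℚΣ.sum f                     ≡⟨ ∑≡sum f ⟨
  ∑ f                          ∎
  where open ≡-Reasoning

∑-const : ∀ m c → ∑ {m} (λ _ → c) ≡ m · c
∑-const zero    c = refl
∑-const (suc m) c = cong (c ℚ.+_) (∑-const m c)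

∑-↑ : ∀ m k (h : Fin (m + k) → ℚ) → ∑ h ≡ ∑ (λ j → h (j ↑ˡ k)) ℚ.+ ∑ (λ j → h (m ↑ʳ j))
∑-↑ zero    k h = sym (ℚ.+-identityˡ (∑ h))
∑-↑ (suc m) k h = trans (cong (h zero ℚ.+_) (∑-↑ m k (h ∘ suc))) (sym (ℚ.+-assoc (h zero) _ _))

∑-nonneg : ∀ {n} {f : Fin n → ℚ} → (∀ i → 0ℚ ℚ.≤ f i) → 0ℚ ℚ.≤ ∑ f
∑-nonneg {zero}  f≥0 = ℚ.≤-refl
∑-nonneg {suc n} f≥0 = ℚ.+-mono-≤ (f≥0 zero) (∑-nonneg (f≥0 ∘ suc))

∑-splitAt : ∀ m {k} (f : Fin m ⊎ Fin k → ℚ) → ∑ (λ i → f (splitAt m i)) ≡ ∑ (f ∘ inj₁) ℚ.+ ∑ (f ∘ inj₂)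
∑-splitAt zero    f = sym (ℚ.+-identityˡ (∑ (f ∘ inj₂)))
∑-splitAt (suc m) f = trans (cong (f (inj₁ zero) ℚ.+_) (∑-splitAt m (f ∘ Sum.map₁ suc)))
                            (sym (ℚ.+-assoc (f (inj₁ zero)) _ _))

term≤∑ : ∀ {n} {f : Fin n → ℚ} → (∀ i → 0ℚ ℚ.≤ f i) → ∀ j → f j ℚ.≤ ∑ f
term≤∑ {suc n} {f} f≥0 zero    = subst (ℚ._≤ ∑ f) (ℚ.+-identityʳ (f zero))
  (ℚ.+-monoʳ-≤ (f zero) (∑-nonneg (f≥0 ∘ suc)))
term≤∑ {suc n} {f} f≥0 (suc j) = subst (ℚ._≤ ∑ f) (ℚ.+-identityˡ (f (suc j)))
  (ℚ.+-mono-≤ (f≥0 zero) (term≤∑ (f≥0 ∘ suc) j))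

∑-÷ : ∀ {n d} → 0 < d → (g : Fin n → ℕ) → ∑ (λ i → g i ÷ d) ≡ ∑ℕ g ÷ d
∑-÷ {zero}  {d} 0<d g = sym (÷-zero d)
∑-÷ {suc n} {d} 0<d g = trans (cong (g zero ÷ d ℚ.+_) (∑-÷ 0<d (g ∘ suc))) (÷-+-same 0<d)

∑ℕ-*ˡ : ∀ {n} c (g : Fin n → ℕ) → ∑ℕ (λ i → c ℕ.* g i) ≡ c ℕ.* ∑ℕ g
∑ℕ-*ˡ {zero}  c g = sym (ℕ.*-zeroʳ c)
∑ℕ-*ˡ {suc n} c g =
  trans (cong (λ z → c ℕ.* g zero + z) (∑ℕ-*ˡ c (g ∘ suc))) (sym (ℕ.*-distribˡ-+ c (g zero) _))

∣p∪q∣≡∣p∣+∣q─p∣ : ∀ {n} (p q : Subset n) → ∣ p ∪ q ∣ ≡ ∣ p ∣ + ∣ q ─ p ∣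
∣p∪q∣≡∣p∣+∣q─p∣ []            []            = refl
∣p∪q∣≡∣p∣+∣q─p∣ (inside  ∷ p) (_       ∷ q) = cong suc (∣p∪q∣≡∣p∣+∣q─p∣ p q)
∣p∪q∣≡∣p∣+∣q─p∣ (outside ∷ p) (inside  ∷ q) = trans (cong suc (∣p∪q∣≡∣p∣+∣q─p∣ p q)) (sym (ℕ.+-suc ∣ p ∣ _))
∣p∪q∣≡∣p∣+∣q─p∣ (outside ∷ p) (outside ∷ q) = ∣p∪q∣≡∣p∣+∣q─p∣ p q

∣p∪q∣≤∣p∣+∣q∣ : ∀ {n} (p q : Subset n) → ∣ p ∪ q ∣ ≤ ∣ p ∣ + ∣ q ∣
∣p∪q∣≤∣p∣+∣q∣ p q = ℕ.≤-trans (ℕ.≤-reflexive (∣p∪q∣≡∣p∣+∣q─p∣ p q)) (ℕ.+-monoʳ-≤ ∣ p ∣ (∣p─q∣≤∣p∣ q p))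

x∈p─q⇒x∉q : ∀ {n} {p q : Subset n} {x} → x ∈ p ─ q → ¬ x ∈ q
x∈p─q⇒x∉q {p = _ ∷ p} {outside ∷ q} here          ()
x∈p─q⇒x∉q {p = _ ∷ p} {_       ∷ q} (there x∈p─q) (there x∈q) = x∈p─q⇒x∉q x∈p─q x∈q

x∈p⇒⁅x⁆⊆p : ∀ {n} {p : Subset n} {x} → x ∈ p → ⁅ x ⁆ ⊆ p
x∈p⇒⁅x⁆⊆p {p = p} {x} x∈p y∈⁅x⁆ = subst (_∈ p) (sym (x∈⁅y⁆⇒x≡y x y∈⁅x⁆)) x∈p

0<∣p∣⇒Nonempty : ∀ {n} (p : Subset n) → 0 < ∣ p ∣ → Nonempty p
0<∣p∣⇒Nonempty {n} p 0<∣p∣ with nonempty? p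
... | yes ne = ne
... | no ∅   = contradiction (trans (cong ∣_∣ (Empty-unique ∅)) (∣⊥∣≡0 n)) (ℕ.>⇒≢ 0<∣p∣)

injective⇒surjective : ∀ {n} {f : Fin n → Fin n} → Injective _≡_ _≡_ f → ∀ j → ∃ λ i → f i ≡ j
injective⇒surjective {suc m} {f} f-injective j with Fin.any? (λ i → f i Fin.≟ j)
... | yes preimage = preimage
... | no  ∄preimage = contradiction (Fin.injective⇒≤ g-injective) ℕ.1+n≰n
  where
  g : Fin (suc m) → Fin m
  g i = punchOut {i = j} (λ j≡fi → ∄preimage (i , sym j≡fi))
  g-injective : Injective _≡_ _≡_ g
  g-injective gi≡gi′ = f-injective (Fin.punchOut-injective {i = j} _ _ gi≡gi′)

injective⇒permutation : ∀ {n} (f : Fin n → Fin n) → Injective _≡_ _≡_ f →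
                        Σ (Permutation′ n) λ σ → ∀ i → σ ⟨$⟩ʳ i ≡ f i
injective⇒permutation f f-injective =
  mk↔ₛ′ f (proj₁ ∘ surjective) (proj₂ ∘ surjective) (λ i → f-injective (proj₂ (surjective (f i)))) ,
  λ _ → refl
  where
  surjective : ∀ j → ∃ λ i → f i ≡ j
  surjective = injective⇒surjective f-injective

-- Hall's marriage theorem

module Hall {n} {E : Fin n → Fin n → Set} (E? : ∀ i j → Dec (E i j)) where

  adjacent? : ∀ S j → Dec (∃ λ i → i ∈ S × E i j)
  adjacent? S j = Fin.any? (λ i → i ∈? S ×-dec E? i j)

  neighbours : Subset n → Subset n
  neighbours S = tabulate (does ∘ adjacent? S)

  ∈neighbours⁺ : ∀ {S i j} → i ∈ S → E i j → j ∈ neighbours S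
  ∈neighbours⁺ {S} {i} {j} i∈S e = Vec.lookup⇒[]= j (neighbours S)
    (trans (Vec.lookup∘tabulate (does ∘ adjacent? S) j) (dec-true (adjacent? S j) (i , i∈S , e)))

  ∈neighbours⁻ : ∀ {S j} → j ∈ neighbours S → ∃ λ i → i ∈ S × E i j
  ∈neighbours⁻ {S} {j} j∈N = invert (subst (Reflects _) adjacent (proof (adjacent? S j)))
    where
    adjacent : does (adjacent? S j) ≡ true
    adjacent = trans (sym (Vec.lookup∘tabulate (does ∘ adjacent? S) j)) (Vec.[]=⇒lookup j∈N)

  neighbours-mono : ∀ {S S′} → S ⊆ S′ → neighbours S ⊆ neighbours S′
  neighbours-mono S⊆S′ j∈N with ∈neighbours⁻ j∈N
  ... | i , i∈S , e = ∈neighbours⁺ (S⊆S′ i∈S) e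

  HallCondition : Subset n → Subset n → Set
  HallCondition R C = ∀ {S} → S ⊆ R → ∣ S ∣ ≤ ∣ C ∩ neighbours S ∣

  record Matching (R C : Subset n) : Set where
    field
      match           : Fin n → Fin n
      match-∈         : ∀ {i} → i ∈ R → match i ∈ C
      match-edge      : ∀ {i} → i ∈ R → E i (match i)
      match-injective : ∀ {i i′} → i ∈ R → i′ ∈ R → match i ≡ match i′ → i ≡ i′

  empty-matching : ∀ {R C} → Empty R → Matching R C
  empty-matching R∅ = record
    { match           = λ i → i
    ; match-∈         = λ i∈R → ⊥-elim (R∅ (_ , i∈R))
    ; match-edge      = λ i∈R → ⊥-elim (R∅ (_ , i∈R))
    ; match-injective = λ i∈R _ _ → ⊥-elim (R∅ (_ , i∈R))
    }

  singleton-matching : ∀ {i c} → E i c → Matching ⁅ i ⁆ ⁅ c ⁆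
  singleton-matching {i} {c} e = record
    { match           = λ _ → c
    ; match-∈         = λ _ → x∈⁅x⁆ c
    ; match-edge      = λ j∈⁅i⁆ → subst (λ j → E j c) (sym (x∈⁅y⁆⇒x≡y i j∈⁅i⁆)) e
    ; match-injective = λ j∈⁅i⁆ j′∈⁅i⁆ _ → trans (x∈⁅y⁆⇒x≡y i j∈⁅i⁆) (sym (x∈⁅y⁆⇒x≡y i j′∈⁅i⁆))
    }

  glue : ∀ {R C C₁} S → C₁ ⊆ C → Matching S C₁ → Matching (R ─ S) (C ─ C₁) → Matching R C
  glue {R} {C} {C₁} S C₁⊆C M₁ M₂ = record
    { match = f ; match-∈ = f-∈ ; match-edge = f-edge ; match-injective = f-injective }
    where
    module M₁ = Matching M₁
    module M₂ = Matching M₂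

    f : Fin n → Fin n
    f i with i ∈? S
    ... | yes _ = M₁.match i
    ... | no  _ = M₂.match i

    f-∈ : ∀ {i} → i ∈ R → f i ∈ C
    f-∈ {i} i∈R with i ∈? S
    ... | yes i∈S = C₁⊆C (M₁.match-∈ i∈S)
    ... | no  i∉S = p─q⊆p C C₁ (M₂.match-∈ (x∈p∧x∉q⇒x∈p─q i∈R i∉S))

    f-edge : ∀ {i} → i ∈ R → E i (f i)
    f-edge {i} i∈R with i ∈? S
    ... | yes i∈S = M₁.match-edge i∈S
    ... | no  i∉S = M₂.match-edge (x∈p∧x∉q⇒x∈p─q i∈R i∉S)

    f-injective : ∀ {i i′} → i ∈ R → i′ ∈ R → f i ≡ f i′ → i ≡ i′
    f-injective {i} {i′} i∈R i′∈R eq with i ∈? S | i′ ∈? S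
    ... | yes i∈S | yes i′∈S = M₁.match-injective i∈S i′∈S eq
    ... | no  i∉S | no  i′∉S = M₂.match-injective (x∈p∧x∉q⇒x∈p─q i∈R i∉S) (x∈p∧x∉q⇒x∈p─q i′∈R i′∉S) eq
    ... | yes i∈S | no  i′∉S = ⊥-elim (x∈p─q⇒x∉q (M₂.match-∈ (x∈p∧x∉q⇒x∈p─q i′∈R i′∉S))
                                                 (subst (_∈ C₁) eq (M₁.match-∈ i∈S)))
    ... | no  i∉S | yes i′∈S = ⊥-elim (x∈p─q⇒x∉q (M₂.match-∈ (x∈p∧x∉q⇒x∈p─q i∈R i∉S))
                                                 (subst (_∈ C₁) (sym eq) (M₁.match-∈ i′∈S)))

  hall-inner : ∀ {R C S} → HallCondition R C → S ⊆ R → HallCondition S (C ∩ neighbours S)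
  hall-inner {R} {C} {S} hall S⊆R {T} T⊆S = ℕ.≤-trans (hall (⊆-trans T⊆S S⊆R)) (p⊆q⇒∣p∣≤∣q∣ shrink)
    where
    shrink : C ∩ neighbours T ⊆ (C ∩ neighbours S) ∩ neighbours T
    shrink j∈ with x∈p∩q⁻ C (neighbours T) j∈
    ... | j∈C , j∈NT = x∈p∩q⁺ (x∈p∩q⁺ (j∈C , neighbours-mono T⊆S j∈NT) , j∈NT)

  hall-outer : ∀ {R C S} → HallCondition R C → S ⊆ R → ∣ C ∩ neighbours S ∣ ≤ ∣ S ∣ →
               HallCondition (R ─ S) (C ─ (C ∩ neighbours S))
  hall-outer {R} {C} {S} hall S⊆R tight {T} T⊆R─S = ℕ.+-cancelˡ-≤ ∣ S ∣ _ _ (begin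
    ∣ S ∣ + ∣ T ∣                   ≤⟨ ℕ.+-monoʳ-≤ ∣ S ∣ (p⊆q⇒∣p∣≤∣q∣ T⊆T─S) ⟩
    ∣ S ∣ + ∣ T ─ S ∣               ≡⟨ ∣p∪q∣≡∣p∣+∣q─p∣ S T ⟨
    ∣ S ∪ T ∣                       ≤⟨ hall S∪T⊆R ⟩
    ∣ C ∩ neighbours (S ∪ T) ∣      ≤⟨ p⊆q⇒∣p∣≤∣q∣ split ⟩
    ∣ C₁ ∪ (C₂ ∩ neighbours T) ∣    ≤⟨ ∣p∪q∣≤∣p∣+∣q∣ C₁ (C₂ ∩ neighbours T) ⟩
    ∣ C₁ ∣ + ∣ C₂ ∩ neighbours T ∣  ≤⟨ ℕ.+-monoˡ-≤ _ tight ⟩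
    ∣ S ∣ + ∣ C₂ ∩ neighbours T ∣   ∎)
    where
    open ℕ.≤-Reasoning
    C₁ C₂ : Subset n
    C₁ = C ∩ neighbours S
    C₂ = C ─ C₁

    T⊆T─S : T ⊆ T ─ S
    T⊆T─S i∈T = x∈p∧x∉q⇒x∈p─q i∈T (x∈p─q⇒x∉q (T⊆R─S i∈T))

    S∪T⊆R : S ∪ T ⊆ R
    S∪T⊆R i∈S∪T with x∈p∪q⁻ S T i∈S∪T
    ... | inj₁ i∈S = S⊆R i∈S
    ... | inj₂ i∈T = p─q⊆p R S (T⊆R─S i∈T)

    split : C ∩ neighbours (S ∪ T) ⊆ C₁ ∪ (C₂ ∩ neighbours T)
    split {j} j∈ with x∈p∩q⁻ C _ j∈
    ... | j∈C , j∈N with ∈neighbours⁻ j∈N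
    ...   | i , i∈S∪T , e with x∈p∪q⁻ S T i∈S∪T | j ∈? C₁
    ...     | inj₁ i∈S | _        = x∈p∪q⁺ (inj₁ (x∈p∩q⁺ (j∈C , ∈neighbours⁺ i∈S e)))
    ...     | inj₂ _   | yes j∈C₁ = x∈p∪q⁺ (inj₁ j∈C₁)
    ...     | inj₂ i∈T | no  j∉C₁ = x∈p∪q⁺ (inj₂ (x∈p∩q⁺ (x∈p∧x∉q⇒x∈p─q j∈C j∉C₁ , ∈neighbours⁺ i∈T e)))

  Surplus : Subset n → Subset n → Set
  Surplus R C = ∀ {S} → S ⊆ R → Nonempty S → ∣ S ∣ < ∣ R ∣ → ∣ S ∣ < ∣ C ∩ neighbours S ∣

  hall-delete : ∀ {R C i c} → Surplus R C → i ∈ R → HallCondition (R - i) (C - c)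
  hall-delete {R} {C} {i} {c} surplus i∈R {T} T⊆R-i with nonempty? T
  ... | no  T∅ = ℕ.≤-trans (ℕ.≤-reflexive (trans (cong ∣_∣ (Empty-unique T∅)) (∣⊥∣≡0 n))) z≤n
  ... | yes T≠∅ = ℕ.≤-pred (begin
    suc ∣ T ∣                               ≤⟨ surplus T⊆R T≠∅ ∣T∣<∣R∣ ⟩
    ∣ C ∩ neighbours T ∣                    ≤⟨ p⊆q⇒∣p∣≤∣q∣ split ⟩
    ∣ ⁅ c ⁆ ∪ ((C - c) ∩ neighbours T) ∣    ≤⟨ ∣p∪q∣≤∣p∣+∣q∣ ⁅ c ⁆ _ ⟩
    ∣ ⁅ c ⁆ ∣ + ∣ (C - c) ∩ neighbours T ∣  ≡⟨ cong (_+ ∣ (C - c) ∩ neighbours T ∣) (∣⁅x⁆∣≡1 c) ⟩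
    suc ∣ (C - c) ∩ neighbours T ∣          ∎)
    where
    open ℕ.≤-Reasoning

    T⊆R : T ⊆ R
    T⊆R = p─q⊆p R ⁅ i ⁆ ∘ T⊆R-i

    ∣T∣<∣R∣ : ∣ T ∣ < ∣ R ∣
    ∣T∣<∣R∣ = ℕ.≤-<-trans (p⊆q⇒∣p∣≤∣q∣ T⊆R-i) (x∈p⇒∣p-x∣<∣p∣ i∈R)

    split : C ∩ neighbours T ⊆ ⁅ c ⁆ ∪ ((C - c) ∩ neighbours T)
    split {j} j∈ with x∈p∩q⁻ C _ j∈ | j Fin.≟ c
    ... | _          , _   | yes refl = x∈p∪q⁺ (inj₁ (x∈⁅x⁆ c))
    ... | j∈C , j∈N | no  j≢c  = x∈p∪q⁺ (inj₂ (x∈p∩q⁺ (x∈p∧x≢y⇒x∈p-y j∈C j≢c , j∈N)))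

  hall-partner : ∀ {R C i} → HallCondition R C → i ∈ R → ∃ λ c → c ∈ C × E i c
  hall-partner {R} {C} {i} hall i∈R with 0<∣p∣⇒Nonempty (C ∩ neighbours ⁅ i ⁆) 1≤∣N⁅i⁆∣
    where
    1≤∣N⁅i⁆∣ : 1 ≤ ∣ C ∩ neighbours ⁅ i ⁆ ∣
    1≤∣N⁅i⁆∣ = subst (_≤ ∣ C ∩ neighbours ⁅ i ⁆ ∣) (∣⁅x⁆∣≡1 i) (hall (x∈p⇒⁅x⁆⊆p i∈R))
  ... | c , c∈ with x∈p∩q⁻ C _ c∈
  ...   | c∈C , c∈N with ∈neighbours⁻ c∈N
  ...     | j , j∈⁅i⁆ , e = c , c∈C , subst (λ k → E k c) (x∈⁅y⁆⇒x≡y i j∈⁅i⁆) e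

  Critical : Subset n → Subset n → Subset n → Set
  Critical R C S = S ⊆ R × Nonempty S × ∣ S ∣ < ∣ R ∣ × ∣ C ∩ neighbours S ∣ ≤ ∣ S ∣

  critical? : ∀ R C S → Dec (Critical R C S)
  critical? R C S = S ⊆? R ×-dec nonempty? S ×-dec ∣ S ∣ ℕ.<? ∣ R ∣ ×-dec ∣ C ∩ neighbours S ∣ ℕ.≤? ∣ S ∣

  -- Halmos–Vaughan: a critical set S splits the problem into S ↦ C ∩ N(S) and R ─ S ↦ C ─ N(S);
  -- without one, any edge i c can be matched first.  The fuel k bounds ∣ R ∣.
  matching : ∀ k {R C} → ∣ R ∣ ≤ k → HallCondition R C → Matching R C
  matching zero {R} ∣R∣≤0 _ = empty-matching λ (i , i∈R) →
    contradiction (ℕ.≤-<-trans z≤n (x∈p⇒∣p-x∣<∣p∣ i∈R)) (ℕ.≤⇒≯ ∣R∣≤0)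
  matching (suc k) {R} {C} ∣R∣≤1+k hall with anySubset? (critical? R C)
  ... | yes (S , S⊆R , (i , i∈S) , ∣S∣<∣R∣ , tight) =
    glue S (p∩q⊆p C _) (matching k ∣S∣≤k (hall-inner {C = C} hall S⊆R))
                       (matching k ∣R─S∣≤k (hall-outer {C = C} hall S⊆R tight))
    where
    ∣S∣≤k : ∣ S ∣ ≤ k
    ∣S∣≤k = ℕ.≤-pred (ℕ.≤-trans ∣S∣<∣R∣ ∣R∣≤1+k)
    ∣R─S∣≤k : ∣ R ─ S ∣ ≤ k
    ∣R─S∣≤k = ℕ.≤-pred (ℕ.≤-trans (p∩q≢∅⇒∣p─q∣<∣p∣ R S (i , x∈p∩q⁺ (S⊆R i∈S , i∈S))) ∣R∣≤1+k)
  ... | no no-critical with nonempty? R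
  ...   | no  R∅       = empty-matching R∅
  ...   | yes (i , i∈R) with hall-partner hall i∈R
  ...     | c , c∈C , e =
    glue ⁅ i ⁆ (x∈p⇒⁅x⁆⊆p c∈C) (singleton-matching e)
              (matching k ∣R-i∣≤k (hall-delete {C = C} {c = c} surplus i∈R))
    where
    ∣R-i∣≤k : ∣ R - i ∣ ≤ k
    ∣R-i∣≤k = ℕ.≤-pred (ℕ.≤-trans (x∈p⇒∣p-x∣<∣p∣ i∈R) ∣R∣≤1+k)
    surplus : Surplus R C
    surplus S⊆R S≠∅ ∣S∣<∣R∣ = ℕ.≰⇒> (λ tight → no-critical (_ , S⊆R , S≠∅ , ∣S∣<∣R∣ , tight))

  hall-permutation : (∀ S → ∣ S ∣ ≤ ∣ neighbours S ∣) → ∃ λ (σ : Permutation′ n) → ∀ i → E i (σ ⟨$⟩ʳ i)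
  hall-permutation hall = proj₁ permutation , λ i → subst (E i) (sym (proj₂ permutation i)) (M.match-edge ∈⊤)
    where
    M : Matching ⊤ ⊤
    M = matching n (∣p∣≤n ⊤) λ {S} _ →
      ℕ.≤-trans (hall S) (p⊆q⇒∣p∣≤∣q∣ {p = neighbours S} λ j∈N → x∈p∩q⁺ (∈⊤ , j∈N))
    module M = Matching M
    permutation : Σ (Permutation′ n) λ σ → ∀ i → σ ⟨$⟩ʳ i ≡ M.match i
    permutation = injective⇒permutation M.match (M.match-injective ∈⊤ ∈⊤)

-- Permutations in the support of a bistochastic matrix

𝟙 : Bool → ℚ
𝟙 true  = 1ℚ
𝟙 false = 0ℚ

𝟙-mono-≤ : ∀ {a b} → (a ≡ true → b ≡ true) → 𝟙 a ℚ.≤ 𝟙 b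
𝟙-mono-≤ {false} {false} _ = ℚ.≤-refl
𝟙-mono-≤ {false} {true}  _ = ÷-nonneg 1 1
𝟙-mono-≤ {true}  {true}  _ = ℚ.≤-refl
𝟙-mono-≤ {true}  {false} a⇒b with a⇒b refl
... | ()

∑-𝟙 : ∀ {n} (S : Subset n) → ∑ (λ i → 𝟙 (lookup S i)) ≡ ∣ S ∣ ÷ 1
∑-𝟙 []            = refl
∑-𝟙 (inside  ∷ S) = trans (cong (1ℚ ℚ.+_) (∑-𝟙 S)) (÷-+-same {1} {∣ S ∣} (s≤s z≤n))
∑-𝟙 (outside ∷ S) = trans (ℚ.+-identityˡ _) (∑-𝟙 S)

support-permutation : ∀ {n} (M : Matrix n) → (∀ i j → 0ℚ ℚ.≤ M i j) →
                      (∀ i → ∑ (M i) ≡ 1ℚ) → (∀ j → ∑ (λ i → M i j) ≡ 1ℚ) →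
                      ∃ λ (σ : Permutation′ n) → ∀ i → ¬ M i (σ ⟨$⟩ʳ i) ≡ 0ℚ
support-permutation {n} M M≥0 rows cols = hall-permutation hall-condition
  where
  open Hall (λ i j → ¬? (M i j ℚ.≟ 0ℚ))
  open ℚ.≤-Reasoning

  flow : ∀ S i j → 𝟙 (lookup S i) ℚ.* M i j ℚ.≤ 𝟙 (lookup (neighbours S) j) ℚ.* M i j
  flow S i j with M i j ℚ.≟ 0ℚ
  ... | yes Mij≡0 rewrite Mij≡0 =
    ℚ.≤-reflexive (trans (ℚ.*-zeroʳ (𝟙 (lookup S i))) (sym (ℚ.*-zeroʳ (𝟙 (lookup (neighbours S) j)))))
  ... | no  Mij≢0 = ℚ.*-monoʳ-≤-nonNeg (M i j) {{ℚ.nonNegative (M≥0 i j)}} (𝟙-mono-≤ λ S[i] →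
    Vec.[]=⇒lookup (∈neighbours⁺ (Vec.lookup⇒[]= i S S[i]) Mij≢0))

  mass-flows : ∀ S → ∣ S ∣ ÷ 1 ℚ.≤ ∣ neighbours S ∣ ÷ 1
  mass-flows S = begin
    ∣ S ∣ ÷ 1                                     ≡⟨ ∑-𝟙 S ⟨
    ∑ (λ i → 𝟙 (lookup S i))                      ≡⟨ ∑-cong (λ i → *-unitʳ (𝟙 (lookup S i)) (rows i)) ⟨
    ∑ (λ i → 𝟙 (lookup S i) ℚ.* ∑ (M i))          ≡⟨ ∑-cong (λ i → ∑-*ˡ (𝟙 (lookup S i)) (M i)) ⟨
    ∑ (λ i → ∑ (λ j → 𝟙 (lookup S i) ℚ.* M i j))  ≤⟨ ∑-mono-≤ (λ i → ∑-mono-≤ (flow S i)) ⟩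
    ∑ (λ i → ∑ (λ j → 𝟙 (lookup N j) ℚ.* M i j))  ≡⟨ ∑-comm (λ i j → 𝟙 (lookup N j) ℚ.* M i j) ⟩
    ∑ (λ j → ∑ (λ i → 𝟙 (lookup N j) ℚ.* M i j))  ≡⟨ ∑-cong (λ j → ∑-*ˡ (𝟙 (lookup N j)) (λ i → M i j)) ⟩
    ∑ (λ j → 𝟙 (lookup N j) ℚ.* ∑ (λ i → M i j))  ≡⟨ ∑-cong (λ j → *-unitʳ (𝟙 (lookup N j)) (cols j)) ⟩
    ∑ (λ j → 𝟙 (lookup N j))                      ≡⟨ ∑-𝟙 N ⟩
    ∣ N ∣ ÷ 1                                     ∎
    where
    N : Subset n
    N = neighbours S

  hall-condition : ∀ S → ∣ S ∣ ≤ ∣ neighbours S ∣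
  hall-condition S = subst₂ _≤_ (ℕ.*-identityʳ ∣ S ∣) (ℕ.*-identityʳ ∣ neighbours S ∣)
    (÷-reflects-≤ {∣ S ∣} {∣ neighbours S ∣} {1} {1} (s≤s z≤n) (s≤s z≤n) (mass-flows S))

-- Dual certificates

record DualCertificate {n} (M : Matrix n) : Set where
  field
    u v   : Fin n → ℚ
    u+v≥0 : ∀ i j → 0ℚ ℚ.≤ u i ℚ.+ v j
    tight : ∀ i j → M i j ≡ 0ℚ ⊎ M i j ≡ u i ℚ.+ v j

  entry-nonneg : ∀ i j → 0ℚ ℚ.≤ M i j
  entry-nonneg i j with tight i j
  ... | inj₁ Mij≡0   = ℚ.≤-reflexive (sym Mij≡0)
  ... | inj₂ Mij≡u+v = subst (0ℚ ℚ.≤_) (sym Mij≡u+v) (u+v≥0 i j)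

  entry≤u+v : ∀ i j → M i j ℚ.≤ u i ℚ.+ v j
  entry≤u+v i j with tight i j
  ... | inj₁ Mij≡0   = subst (ℚ._≤ u i ℚ.+ v j) (sym Mij≡0) (u+v≥0 i j)
  ... | inj₂ Mij≡u+v = ℚ.≤-reflexive Mij≡u+v

  entry² : ∀ i j → M i j ℚ.* M i j ≡ u i ℚ.* M i j ℚ.+ v j ℚ.* M i j
  entry² i j with tight i j
  ... | inj₁ Mij≡0   rewrite Mij≡0 = sym (cong₂ ℚ._+_ (ℚ.*-zeroʳ (u i)) (ℚ.*-zeroʳ (v j)))
  ... | inj₂ Mij≡u+v = trans (cong (ℚ._* M i j) Mij≡u+v) (ℚ.*-distribʳ-+ (M i j) (u i) (v j))

  ∑-potentials : ∀ (τ : Permutation′ n) → ∑ (λ i → u i ℚ.+ v (τ ⟨$⟩ʳ i)) ≡ ∑ u ℚ.+ ∑ v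
  ∑-potentials τ = trans (∑-distrib-+ u (λ i → v (τ ⟨$⟩ʳ i))) (cong (∑ u ℚ.+_) (∑-permute v τ))

erdos-criterion : ∀ {n} (M : Matrix n) → DualCertificate M →
                  (∀ i → ∑ (M i) ≡ 1ℚ) → (∀ j → ∑ (λ i → M i j) ≡ 1ℚ) → Erdos M
erdos-criterion M cert rows cols =
  bistochastic , attained (support-permutation M entry-nonneg rows cols) , tr≤sumSq
  where
  open DualCertificate cert

  bistochastic : Bistochastic M
  bistochastic = (λ i j → entry-nonneg i j , subst (M i j ℚ.≤_) (rows i) (term≤∑ (entry-nonneg i) j)) ,
                 rows , cols

  sumSq≡∑u+∑v : sumSq M ≡ ∑ u ℚ.+ ∑ v
  sumSq≡∑u+∑v = begin
    ∑ (λ i → ∑ (λ j → M i j ℚ.* M i j))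
      ≡⟨ ∑-cong (λ i → trans (∑-cong (entry² i)) (∑-distrib-+ (λ j → u i ℚ.* M i j) (λ j → v j ℚ.* M i j))) ⟩
    ∑ (λ i → ∑ (λ j → u i ℚ.* M i j) ℚ.+ ∑ (λ j → v j ℚ.* M i j))
      ≡⟨ ∑-distrib-+ (λ i → ∑ (λ j → u i ℚ.* M i j)) (λ i → ∑ (λ j → v j ℚ.* M i j)) ⟩
    ∑ (λ i → ∑ (λ j → u i ℚ.* M i j)) ℚ.+ ∑ (λ i → ∑ (λ j → v j ℚ.* M i j))
      ≡⟨ cong (∑ (λ i → ∑ (λ j → u i ℚ.* M i j)) ℚ.+_) (∑-comm (λ i j → v j ℚ.* M i j)) ⟩
    ∑ (λ i → ∑ (λ j → u i ℚ.* M i j)) ℚ.+ ∑ (λ j → ∑ (λ i → v j ℚ.* M i j))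
      ≡⟨ cong₂ ℚ._+_ (∑-cong λ i → trans (∑-*ˡ (u i) (M i)) (*-unitʳ (u i) (rows i)))
                     (∑-cong λ j → trans (∑-*ˡ (v j) (λ i → M i j)) (*-unitʳ (v j) (cols j))) ⟩
    ∑ u ℚ.+ ∑ v ∎
    where open ≡-Reasoning

  tr≤sumSq : ∀ τ → tr[ τ ] M ℚ.≤ sumSq M
  tr≤sumSq τ = begin
    ∑ (λ i → M i (τ ⟨$⟩ʳ i))             ≤⟨ ∑-mono-≤ (λ i → entry≤u+v i (τ ⟨$⟩ʳ i)) ⟩
    ∑ (λ i → u i ℚ.+ v (τ ⟨$⟩ʳ i))       ≡⟨ trans (∑-potentials τ) (sym sumSq≡∑u+∑v) ⟩
    sumSq M                              ∎
    where open ℚ.≤-Reasoning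

  attained : (∃ λ σ → ∀ i → ¬ M i (σ ⟨$⟩ʳ i) ≡ 0ℚ) → ∃ λ σ → tr[ σ ] M ≡ sumSq M
  attained (σ , σ-in-support) = σ , (begin
    ∑ (λ i → M i (σ ⟨$⟩ʳ i))             ≡⟨ ∑-cong on-support ⟩
    ∑ (λ i → u i ℚ.+ v (σ ⟨$⟩ʳ i))       ≡⟨ trans (∑-potentials σ) (sym sumSq≡∑u+∑v) ⟩
    sumSq M                              ∎)
    where
    open ≡-Reasoning
    on-support : ∀ i → M i (σ ⟨$⟩ʳ i) ≡ u i ℚ.+ v (σ ⟨$⟩ʳ i)
    on-support i with tight i (σ ⟨$⟩ʳ i)
    ... | inj₁ Mσ≡0   = contradiction Mσ≡0 (σ-in-support i)
    ... | inj₂ Mσ≡u+v = Mσ≡u+v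

Erdos-cong : ∀ {n} {M N : Matrix n} → (∀ i j → M i j ≡ N i j) → Erdos M → Erdos N
Erdos-cong {M = M} {N} M≗N ((bounds , rows , cols) , (σ , tr[σ]≡sumSq) , tr≤sumSq) =
  ((λ i j → subst (λ z → (0ℚ ℚ.≤ z) × (z ℚ.≤ 1ℚ)) (M≗N i j) (bounds i j)) ,
   (λ i → trans (sym (∑-cong (M≗N i))) (rows i)) ,
   (λ j → trans (sym (∑-cong (λ i → M≗N i j))) (cols j))) ,
  (σ , trans (sym (tr-cong σ)) (trans tr[σ]≡sumSq sumSq-cong)) ,
  (λ τ → subst₂ ℚ._≤_ (tr-cong τ) sumSq-cong (tr≤sumSq τ))
  where
  tr-cong : ∀ τ → tr[ τ ] M ≡ tr[ τ ] N
  tr-cong τ = ∑-cong (λ i → M≗N i (τ ⟨$⟩ʳ i))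
  sumSq-cong : sumSq M ≡ sumSq N
  sumSq-cong = ∑-cong (λ i → ∑-cong (λ j → cong₂ ℚ._*_ (M≗N i j) (M≗N i j)))

blockSum : List ℕ → (ℕ → ℚ) → ℚ
blockSum []       g = 0ℚ
blockSum (m ∷ ms) g = m · g 0 ℚ.+ blockSum ms (g ∘ suc)

Block : List ℕ → ℕ → Set
Block ms b = b < len ms × 0 < at ms b

blockOf-head : ∀ {m} ms x → x < m → blockOf (m ∷ ms) x ≡ 0
blockOf-head ms zero    (s≤s _)   = refl
blockOf-head ms (suc x) (s≤s x<m) = blockOf-head ms x x<m

blockOf-tail : ∀ m ms y → blockOf (m ∷ ms) (m + y) ≡ suc (blockOf ms y)
blockOf-tail zero    ms y = refl
blockOf-tail (suc m) ms y = blockOf-tail m ms y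

blockOf-block : ∀ ms x → x < total ms → Block ms (blockOf ms x)
blockOf-block (m ∷ ms) x x<total with x ℕ.<? m
... | yes x<m rewrite blockOf-head ms x x<m = s≤s z≤n , ℕ.≤-<-trans z≤n x<m
... | no  x≮m with ℕ.m≤n⇒∃[o]m+o≡n (ℕ.≮⇒≥ x≮m)
...   | y , refl rewrite blockOf-tail m ms y =
  map₁ s≤s (blockOf-block ms y (ℕ.+-cancelˡ-< m y (total ms) x<total))

∑-blockOf : ∀ ms {n} → total ms ≡ n → (g : ℕ → ℚ) → ∑ {n} (λ x → g (blockOf ms (toℕ x))) ≡ blockSum ms g
∑-blockOf []       refl g = refl
∑-blockOf (m ∷ ms) refl g = begin
  ∑ {m + total ms} (λ x → g (blockOf (m ∷ ms) (toℕ x)))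
    ≡⟨ ∑-↑ m (total ms) (λ x → g (blockOf (m ∷ ms) (toℕ x))) ⟩
  ∑ {m} (λ x → g (blockOf (m ∷ ms) (toℕ (x ↑ˡ total ms)))) ℚ.+
  ∑ {total ms} (λ y → g (blockOf (m ∷ ms) (toℕ (m ↑ʳ y))))
    ≡⟨ cong₂ ℚ._+_ (∑-cong head) (∑-cong tail) ⟩
  ∑ {m} (λ _ → g 0) ℚ.+ ∑ {total ms} (λ y → g (suc (blockOf ms (toℕ y))))
    ≡⟨ cong₂ ℚ._+_ (∑-const m (g 0)) (∑-blockOf ms refl (g ∘ suc)) ⟩
  m · g 0 ℚ.+ blockSum ms (g ∘ suc) ∎
  where
  open ≡-Reasoning
  head : ∀ (x : Fin m) → g (blockOf (m ∷ ms) (toℕ (x ↑ˡ total ms))) ≡ g 0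
  head x = cong g (trans (cong (blockOf (m ∷ ms)) (Fin.toℕ-↑ˡ x (total ms)))
                         (blockOf-head ms (toℕ x) (Fin.toℕ<n x)))
  tail : ∀ (y : Fin (total ms)) → g (blockOf (m ∷ ms) (toℕ (m ↑ʳ y))) ≡ g (suc (blockOf ms (toℕ y)))
  tail y = cong g (trans (cong (blockOf (m ∷ ms)) (Fin.toℕ-↑ʳ m y)) (blockOf-tail m ms (toℕ y)))

block-erdos : ∀ (r s : List ℕ) {n} (B : ℕ → ℕ → ℚ) (U V : ℕ → ℚ) → total r ≡ n → total s ≡ n →
              (∀ {a b} → Block r a → Block s b → 0ℚ ℚ.≤ U a ℚ.+ V b) →
              (∀ {a b} → Block r a → Block s b → B a b ≡ 0ℚ ⊎ B a b ≡ U a ℚ.+ V b) →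
              (∀ {a} → Block r a → blockSum s (B a) ≡ 1ℚ) →
              (∀ {b} → Block s b → blockSum r (λ a → B a b) ≡ 1ℚ) →
              Erdos {n} (λ i j → B (blockOf r (toℕ i)) (blockOf s (toℕ j)))
block-erdos r s B U V refl s-total U+V≥0 tight rows cols = erdos-criterion _ certificate
  (λ i → trans (∑-blockOf s s-total (B (row i))) (rows (row-block i)))
  (λ j → trans (∑-blockOf r refl (λ a → B a (col j))) (cols (col-block j)))
  where
  row col : Fin (total r) → ℕ
  row i = blockOf r (toℕ i)
  col j = blockOf s (toℕ j)
  row-block : ∀ i → Block r (row i)
  row-block i = blockOf-block r (toℕ i) (Fin.toℕ<n i)
  col-block : ∀ j → Block s (col j)
  col-block j = blockOf-block s (toℕ j) (subst (toℕ j <_) (sym s-total) (Fin.toℕ<n j))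
  certificate : DualCertificate (λ i j → B (row i) (col j))
  certificate = record
    { u = U ∘ row ; v = V ∘ col
    ; u+v≥0 = λ i j → U+V≥0 (row-block i) (col-block j)
    ; tight = λ i j → tight (row-block i) (col-block j) }

-- Staircase matrices

-- The value of X^(r̄,s̄) on block (a , b), so that Xrs r s n i j reduces to
-- α r s (blockOf r (toℕ i)) (blockOf s (toℕ j)).
α : List ℕ → List ℕ → ℕ → ℕ → ℚ
α r s a b =
  if b ≡ᵇ a then frac (ℤ.+ psum s (suc a) ℤ.- ℤ.+ psum r a) (at r a ℕ.* at s a)
  else if b ≡ᵇ suc a then frac (ℤ.+ psum r (suc a) ℤ.- ℤ.+ psum s (suc a)) (at r a ℕ.* at s (suc a))
  else 0ℚ

module Staircase₁ (s₁ t : ℕ) (0<s₁ : 0 < s₁) where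

  R₁ : ℕ
  R₁ = s₁ + t

  r̄ s̄ : List ℕ
  r̄ = R₁ ∷ []
  s̄ = s₁ ∷ t ∷ []

  0<R₁ : 0 < R₁
  0<R₁ = ℕ.≤-trans 0<s₁ (ℕ.m≤m+n s₁ t)

  α₀₀ : α r̄ s̄ 0 0 ≡ s₁ ÷ (R₁ ℕ.* s₁)
  α₀₀ = frac-diff {psum s̄ 1} {psum r̄ 0} (R₁ ℕ.* s₁) (ℕ.+-identityʳ s₁)
  α₀₁ : α r̄ s̄ 0 1 ≡ t ÷ (R₁ ℕ.* t)
  α₀₁ = frac-diff {psum r̄ 1} {psum s̄ 1} (R₁ ℕ.* t)
    (solve 2 (λ s₁ t → (s₁ :+ t) :+ con 0 := (s₁ :+ con 0) :+ t) refl s₁ t)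

  -- Here X^(r̄,s̄) is the constant matrix with entries 1 / R₁.
  U V : ℕ → ℚ
  U _ = 0ℚ
  V _ = 1 ÷ R₁

  tight : ∀ {a b} → Block r̄ a → Block s̄ b → α r̄ s̄ a b ≡ 0ℚ ⊎ α r̄ s̄ a b ≡ U a ℚ.+ V b
  tight {0} {0} _ _         = inj₂ (trans α₀₀ (trans (÷-cancel 0<s₁ 0<R₁) (sym (ℚ.+-identityˡ (1 ÷ R₁)))))
  tight {0} {1} _ (_ , 0<t) = inj₂ (trans α₀₁ (trans (÷-cancel 0<t 0<R₁) (sym (ℚ.+-identityˡ (1 ÷ R₁)))))
  tight {suc _}                 (s≤s () , _) _
  tight {0} {suc (suc _)} _ (s≤s (s≤s ()) , _)

  rows : ∀ {a} → Block r̄ a → blockSum s̄ (α r̄ s̄ a) ≡ 1ℚ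
  rows {0} _ = begin
    s₁ · α r̄ s̄ 0 0 ℚ.+ (t · α r̄ s̄ 0 1 ℚ.+ 0ℚ)
      ≡⟨ cong₂ ℚ._+_ (trans (cong (s₁ ·_) α₀₀) (·-self-÷ s₁ 0<R₁))
                     (trans (ℚ.+-identityʳ (t · α r̄ s̄ 0 1)) (trans (cong (t ·_) α₀₁) (·-self-÷ t 0<R₁)))
      ⟩
    s₁ ÷ R₁ ℚ.+ t ÷ R₁           ≡⟨ ÷-+-same 0<R₁ ⟩
    R₁ ÷ R₁                       ≡⟨ ÷-self 0<R₁ ⟩
    1ℚ                            ∎
    where open ≡-Reasoning
  rows {suc _} (s≤s () , _)

  cols : ∀ {b} → Block s̄ b → blockSum r̄ (λ a → α r̄ s̄ a b) ≡ 1ℚ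
  cols {0} _ = begin
    R₁ · α r̄ s̄ 0 0 ℚ.+ 0ℚ        ≡⟨ ℚ.+-identityʳ (R₁ · α r̄ s̄ 0 0) ⟩
    R₁ · α r̄ s̄ 0 0               ≡⟨ trans (cong (R₁ ·_) α₀₀) (·-÷-cancelˡ s₁ 0<R₁ 0<s₁) ⟩
    s₁ ÷ s₁                       ≡⟨ ÷-self 0<s₁ ⟩
    1ℚ                            ∎
    where open ≡-Reasoning
  cols {1} (_ , 0<t) = begin
    R₁ · α r̄ s̄ 0 1 ℚ.+ 0ℚ        ≡⟨ ℚ.+-identityʳ (R₁ · α r̄ s̄ 0 1) ⟩
    R₁ · α r̄ s̄ 0 1               ≡⟨ trans (cong (R₁ ·_) α₀₁) (·-÷-cancelˡ t 0<R₁ 0<t) ⟩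
    t ÷ t                         ≡⟨ ÷-self 0<t ⟩
    1ℚ                            ∎
    where open ≡-Reasoning
  cols {suc (suc _)} (s≤s (s≤s ()) , _)

  total-s : total s̄ ≡ total r̄
  total-s = solve 2 (λ s₁ t → s₁ :+ (t :+ con 0) := (s₁ :+ t) :+ con 0) refl s₁ t

  erdos : Erdos (Xrs r̄ s̄ (total r̄))
  erdos = block-erdos r̄ s̄ (α r̄ s̄) U V refl total-s (λ _ _ → ℚ.+-mono-≤ ℚ.≤-refl (÷-nonneg 1 R₁))
                      tight rows cols

-- The case k = 2 with r₁ = s₁ + x and s₂ = x + y, so that the interlacing s₁ < r₁ < s₁ + s₂
-- becomes 0 < x, 0 < y; the last column block t may be void.
module Staircase₂ (s₁ x y t : ℕ) (0<s₁ : 0 < s₁) (0<x : 0 < x) (0<y : 0 < y) where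

  R₁ R₂ S₂ : ℕ
  R₁ = s₁ + x
  S₂ = x + y
  R₂ = y + t

  r̄ s̄ : List ℕ
  r̄ = R₁ ∷ R₂ ∷ []
  s̄ = s₁ ∷ S₂ ∷ t ∷ []

  0<R₁ : 0 < R₁
  0<R₁ = ℕ.≤-trans 0<s₁ (ℕ.m≤m+n s₁ x)
  0<S₂ : 0 < S₂
  0<S₂ = ℕ.≤-trans 0<x (ℕ.m≤m+n x y)
  0<R₂ : 0 < R₂
  0<R₂ = ℕ.≤-trans 0<y (ℕ.m≤m+n y t)

  α₀₀ : α r̄ s̄ 0 0 ≡ s₁ ÷ (R₁ ℕ.* s₁)
  α₀₀ = frac-diff {psum s̄ 1} {psum r̄ 0} (R₁ ℕ.* s₁) (ℕ.+-identityʳ s₁)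
  α₀₁ : α r̄ s̄ 0 1 ≡ x ÷ (R₁ ℕ.* S₂)
  α₀₁ = frac-diff {psum r̄ 1} {psum s̄ 1} (R₁ ℕ.* S₂)
    (solve 2 (λ s₁ x → (s₁ :+ x) :+ con 0 := (s₁ :+ con 0) :+ x) refl s₁ x)
  α₁₁ : α r̄ s̄ 1 1 ≡ y ÷ (R₂ ℕ.* S₂)
  α₁₁ = frac-diff {psum s̄ 2} {psum r̄ 1} (R₂ ℕ.* S₂)
    (solve 3 (λ s₁ x y → s₁ :+ ((x :+ y) :+ con 0) := ((s₁ :+ x) :+ con 0) :+ y) refl s₁ x y)
  α₁₂ : α r̄ s̄ 1 2 ≡ t ÷ (R₂ ℕ.* t)
  α₁₂ = frac-diff {psum r̄ 2} {psum s̄ 2} (R₂ ℕ.* t)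
    (solve 4 (λ s₁ x y t → (s₁ :+ x) :+ ((y :+ t) :+ con 0) := (s₁ :+ ((x :+ y) :+ con 0)) :+ t) refl s₁ x y t)

  -- The solution of α a a = U a + V a and α a (1 + a) = U a + V (1 + a) with V 1 = 0.
  U V : ℕ → ℚ
  U zero          = x ÷ (R₁ ℕ.* S₂)
  U (suc _)       = y ÷ (R₂ ℕ.* S₂)
  V zero          = y ÷ (R₁ ℕ.* S₂)
  V (suc zero)    = 0ℚ
  V (suc (suc _)) = x ÷ (R₂ ℕ.* S₂)

  U+V≥0 : ∀ a b → 0ℚ ℚ.≤ U a ℚ.+ V b
  U+V≥0 a b = ℚ.+-mono-≤ (U≥0 a) (V≥0 b)
    where
    U≥0 : ∀ a → 0ℚ ℚ.≤ U a
    U≥0 zero    = ÷-nonneg x (R₁ ℕ.* S₂)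
    U≥0 (suc _) = ÷-nonneg y (R₂ ℕ.* S₂)
    V≥0 : ∀ b → 0ℚ ℚ.≤ V b
    V≥0 zero          = ÷-nonneg y (R₁ ℕ.* S₂)
    V≥0 (suc zero)    = ℚ.≤-refl
    V≥0 (suc (suc _)) = ÷-nonneg x (R₂ ℕ.* S₂)

  tight : ∀ {a b} → Block r̄ a → Block s̄ b → α r̄ s̄ a b ≡ 0ℚ ⊎ α r̄ s̄ a b ≡ U a ℚ.+ V b
  tight {0} {0} _ _ = inj₂ (begin
    α r̄ s̄ 0 0                              ≡⟨ α₀₀ ⟩
    s₁ ÷ (R₁ ℕ.* s₁)                       ≡⟨ ÷-cancel 0<s₁ 0<R₁ ⟩
    1 ÷ R₁                                 ≡⟨ ÷-cancel 0<S₂ 0<R₁ ⟨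
    S₂ ÷ (R₁ ℕ.* S₂)                       ≡⟨ ÷-+-same (ℕ.*-mono-≤ 0<R₁ 0<S₂) ⟨
    x ÷ (R₁ ℕ.* S₂) ℚ.+ y ÷ (R₁ ℕ.* S₂)   ∎)
    where open ≡-Reasoning
  tight {0} {1} _ _ = inj₂ (trans α₀₁ (sym (ℚ.+-identityʳ _)))
  tight {0} {2} _ _ = inj₁ refl
  tight {1} {0} _ _ = inj₁ refl
  tight {1} {1} _ _ = inj₂ (trans α₁₁ (sym (ℚ.+-identityʳ _)))
  tight {1} {2} _ (_ , 0<t) = inj₂ (begin
    α r̄ s̄ 1 2                              ≡⟨ α₁₂ ⟩
    t ÷ (R₂ ℕ.* t)                         ≡⟨ ÷-cancel 0<t 0<R₂ ⟩
    1 ÷ R₂                                 ≡⟨ ÷-cancel 0<S₂ 0<R₂ ⟨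
    S₂ ÷ (R₂ ℕ.* S₂)                       ≡⟨ cong (_÷ (R₂ ℕ.* S₂)) (ℕ.+-comm x y) ⟩
    (y + x) ÷ (R₂ ℕ.* S₂)                  ≡⟨ ÷-+-same (ℕ.*-mono-≤ 0<R₂ 0<S₂) ⟨
    y ÷ (R₂ ℕ.* S₂) ℚ.+ x ÷ (R₂ ℕ.* S₂)   ∎)
    where open ≡-Reasoning
  tight {suc (suc _)}         (s≤s (s≤s ()) , _) _
  tight {0} {suc (suc (suc _))} _ (s≤s (s≤s (s≤s ())) , _)
  tight {1} {suc (suc (suc _))} _ (s≤s (s≤s (s≤s ())) , _)

  rows : ∀ {a} → Block r̄ a → blockSum s̄ (α r̄ s̄ a) ≡ 1ℚ
  rows {0} _ = begin
    s₁ · α r̄ s̄ 0 0 ℚ.+ (S₂ · α r̄ s̄ 0 1 ℚ.+ (t · 0ℚ ℚ.+ 0ℚ))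
      ≡⟨ cong₂ ℚ._+_ (trans (cong (s₁ ·_) α₀₀) (·-self-÷ s₁ 0<R₁))
                     (cong₂ ℚ._+_ (trans (cong (S₂ ·_) α₀₁) (·-÷-cancelʳ x 0<S₂ 0<R₁))
                                  (trans (ℚ.+-identityʳ (t · 0ℚ)) (·-zeroʳ t))) ⟩
    s₁ ÷ R₁ ℚ.+ (x ÷ R₁ ℚ.+ 0ℚ)  ≡⟨ cong (s₁ ÷ R₁ ℚ.+_) (ℚ.+-identityʳ (x ÷ R₁)) ⟩
    s₁ ÷ R₁ ℚ.+ x ÷ R₁           ≡⟨ ÷-+-same 0<R₁ ⟩
    R₁ ÷ R₁                       ≡⟨ ÷-self 0<R₁ ⟩
    1ℚ                            ∎
    where open ≡-Reasoning
  rows {1} _ = begin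
    s₁ · 0ℚ ℚ.+ (S₂ · α r̄ s̄ 1 1 ℚ.+ (t · α r̄ s̄ 1 2 ℚ.+ 0ℚ))
      ≡⟨ cong₂ ℚ._+_ (·-zeroʳ s₁)
                     (cong₂ ℚ._+_ (trans (cong (S₂ ·_) α₁₁) (·-÷-cancelʳ y 0<S₂ 0<R₂))
                                  (trans (ℚ.+-identityʳ (t · α r̄ s̄ 1 2))
                                         (trans (cong (t ·_) α₁₂) (·-self-÷ t 0<R₂)))) ⟩
    0ℚ ℚ.+ (y ÷ R₂ ℚ.+ t ÷ R₂)   ≡⟨ ℚ.+-identityˡ (y ÷ R₂ ℚ.+ t ÷ R₂) ⟩
    y ÷ R₂ ℚ.+ t ÷ R₂            ≡⟨ ÷-+-same 0<R₂ ⟩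
    R₂ ÷ R₂                       ≡⟨ ÷-self 0<R₂ ⟩
    1ℚ                            ∎
    where open ≡-Reasoning
  rows {suc (suc _)} (s≤s (s≤s ()) , _)

  cols : ∀ {b} → Block s̄ b → blockSum r̄ (λ a → α r̄ s̄ a b) ≡ 1ℚ
  cols {0} _ = begin
    R₁ · α r̄ s̄ 0 0 ℚ.+ (R₂ · 0ℚ ℚ.+ 0ℚ)
      ≡⟨ cong₂ ℚ._+_ (trans (cong (R₁ ·_) α₀₀) (·-÷-cancelˡ s₁ 0<R₁ 0<s₁))
                     (trans (ℚ.+-identityʳ (R₂ · 0ℚ)) (·-zeroʳ R₂)) ⟩
    s₁ ÷ s₁ ℚ.+ 0ℚ               ≡⟨ ℚ.+-identityʳ (s₁ ÷ s₁) ⟩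
    s₁ ÷ s₁                       ≡⟨ ÷-self 0<s₁ ⟩
    1ℚ                            ∎
    where open ≡-Reasoning
  cols {1} _ = begin
    R₁ · α r̄ s̄ 0 1 ℚ.+ (R₂ · α r̄ s̄ 1 1 ℚ.+ 0ℚ)
      ≡⟨ cong₂ ℚ._+_ (trans (cong (R₁ ·_) α₀₁) (·-÷-cancelˡ x 0<R₁ 0<S₂))
                     (trans (ℚ.+-identityʳ (R₂ · α r̄ s̄ 1 1))
                            (trans (cong (R₂ ·_) α₁₁) (·-÷-cancelˡ y 0<R₂ 0<S₂))) ⟩
    x ÷ S₂ ℚ.+ y ÷ S₂            ≡⟨ ÷-+-same 0<S₂ ⟩
    S₂ ÷ S₂                       ≡⟨ ÷-self 0<S₂ ⟩
    1ℚ                            ∎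
    where open ≡-Reasoning
  cols {2} (_ , 0<t) = begin
    R₁ · 0ℚ ℚ.+ (R₂ · α r̄ s̄ 1 2 ℚ.+ 0ℚ)
      ≡⟨ cong₂ ℚ._+_ (·-zeroʳ R₁) (trans (ℚ.+-identityʳ (R₂ · α r̄ s̄ 1 2))
                                         (trans (cong (R₂ ·_) α₁₂) (·-÷-cancelˡ t 0<R₂ 0<t))) ⟩
    0ℚ ℚ.+ t ÷ t                  ≡⟨ ℚ.+-identityˡ (t ÷ t) ⟩
    t ÷ t                         ≡⟨ ÷-self 0<t ⟩
    1ℚ                            ∎
    where open ≡-Reasoning
  cols {suc (suc (suc _))} (s≤s (s≤s (s≤s ())) , _)

  total-s : total s̄ ≡ total r̄
  total-s = solve 4 (λ s₁ x y t → s₁ :+ ((x :+ y) :+ (t :+ con 0)) := (s₁ :+ x) :+ ((y :+ t) :+ con 0))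
                    refl s₁ x y t

  erdos : Erdos (Xrs r̄ s̄ (total r̄))
  erdos = block-erdos r̄ s̄ (α r̄ s̄) U V refl total-s (λ {a} {b} _ _ → U+V≥0 a b) tight rows cols

interlacing : ∀ {r₁ r₂ s₁ s₂ s₃} → s₁ < r₁ → r₁ < s₁ + s₂ → r₁ + r₂ ≡ s₁ + s₂ + s₃ →
              ∃ λ x → ∃ λ y → 0 < x × 0 < y × r₁ ≡ s₁ + x × s₂ ≡ x + y × r₂ ≡ y + s₃
interlacing {r₁} {r₂} {s₁} {s₂} {s₃} s₁<r₁ r₁<s₁+s₂ r₁+r₂≡s₁+s₂+s₃
  with m<n⇒∃[o>0]n≡m+o s₁<r₁ | m<n⇒∃[o>0]n≡m+o r₁<s₁+s₂
... | x , 0<x , r₁≡s₁+x | y , 0<y , s₁+s₂≡r₁+y = x , y , 0<x , 0<y , r₁≡s₁+x ,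
  ℕ.+-cancelˡ-≡ s₁ s₂ (x + y) (trans s₁+s₂≡r₁+y (trans (cong (_+ y) r₁≡s₁+x) (ℕ.+-assoc s₁ x y))) ,
  ℕ.+-cancelˡ-≡ r₁ r₂ (y + s₃) (trans r₁+r₂≡s₁+s₂+s₃ (trans (cong (_+ s₃) s₁+s₂≡r₁+y) (ℕ.+-assoc r₁ y s₃)))

staircase₁-erdos : ∀ {r₁ s₁ s₂ n} → 0 < s₁ → r₁ + 0 ≡ n → s₁ + (s₂ + 0) ≡ n →
                   Erdos (Xrs (r₁ ∷ []) (s₁ ∷ s₂ ∷ []) n)
staircase₁-erdos {r₁} {s₁} {s₂} 0<s₁ refl s-total =
  subst (λ r₁ → Erdos (Xrs (r₁ ∷ []) (s₁ ∷ s₂ ∷ []) (r₁ + 0))) (sym r₁≡s₁+s₂) (Staircase₁.erdos s₁ s₂ 0<s₁)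
  where
  r₁≡s₁+s₂ : r₁ ≡ s₁ + s₂
  r₁≡s₁+s₂ = trans (sym (ℕ.+-identityʳ r₁)) (trans (sym s-total) (cong (s₁ +_) (ℕ.+-identityʳ s₂)))

staircase₂-erdos : ∀ {r₁ r₂ s₁ s₂ s₃ n} → 0 < s₁ → s₁ < r₁ → r₁ < s₁ + s₂ →
                   r₁ + (r₂ + 0) ≡ n → s₁ + (s₂ + (s₃ + 0)) ≡ n →
                   Erdos (Xrs (r₁ ∷ r₂ ∷ []) (s₁ ∷ s₂ ∷ s₃ ∷ []) n)
staircase₂-erdos {r₁} {r₂} {s₁} {s₂} {s₃} 0<s₁ s₁<r₁ r₁<s₁+s₂ refl s-total
  with interlacing s₁<r₁ r₁<s₁+s₂ totals
  where
  totals : r₁ + r₂ ≡ s₁ + s₂ + s₃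
  totals = begin
    r₁ + r₂               ≡⟨ cong (r₁ +_) (ℕ.+-identityʳ r₂) ⟨
    r₁ + (r₂ + 0)         ≡⟨ s-total ⟨
    s₁ + (s₂ + (s₃ + 0))  ≡⟨ solve 3 (λ s₁ s₂ s₃ → s₁ :+ (s₂ :+ (s₃ :+ con 0)) := s₁ :+ s₂ :+ s₃) refl s₁ s₂ s₃ ⟩
    s₁ + s₂ + s₃          ∎
    where open ≡-Reasoning
... | x , y , 0<x , 0<y , refl , refl , refl = Staircase₂.erdos s₁ x y s₃ 0<s₁ 0<x 0<y

staircase-erdos : (r s : List ℕ) (n : ℕ) → Admissible r s n → Erdos (Xrs r s n)
staircase-erdos (r₁ ∷ []) (s₁ ∷ s₂ ∷ []) n (_ , _ , _ , s>0 , _ , r-total , s-total) =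
  staircase₁-erdos (s>0 0 (s≤s z≤n)) r-total s-total
staircase-erdos (r₁ ∷ r₂ ∷ []) (s₁ ∷ s₂ ∷ s₃ ∷ []) n (_ , _ , _ , s>0 , interlaced , r-total , s-total)
  with interlaced 1 (s≤s z≤n) (s≤s (s≤s z≤n))
... | s₁<r₁ , r₁<s₁+s₂ = staircase₂-erdos (s>0 0 (s≤s z≤n))
  (subst₂ _<_ (ℕ.+-identityʳ s₁) (ℕ.+-identityʳ r₁) s₁<r₁)
  (subst₂ _<_ (ℕ.+-identityʳ r₁) (cong (s₁ +_) (ℕ.+-identityʳ s₂)) r₁<s₁+s₂) r-total s-total
staircase-erdos []                  _ _ (inj₁ () , _)
staircase-erdos []                  _ _ (inj₂ () , _)
staircase-erdos (_ ∷ _ ∷ _ ∷ _)     _ _ (inj₁ () , _)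
staircase-erdos (_ ∷ _ ∷ _ ∷ _)     _ _ (inj₂ () , _)
staircase-erdos (_ ∷ []) []                  _ (_ , () , _)
staircase-erdos (_ ∷ []) (_ ∷ [])            _ (_ , () , _)
staircase-erdos (_ ∷ []) (_ ∷ _ ∷ _ ∷ _)     _ (_ , () , _)
staircase-erdos (_ ∷ _ ∷ []) []              _ (_ , () , _)
staircase-erdos (_ ∷ _ ∷ []) (_ ∷ [])        _ (_ , () , _)
staircase-erdos (_ ∷ _ ∷ []) (_ ∷ _ ∷ [])    _ (_ , () , _)
staircase-erdos (_ ∷ _ ∷ []) (_ ∷ _ ∷ _ ∷ _ ∷ _) _ (_ , () , _)

-- X^(r,s,n) written with r = s + x and n = r + y.
module TwoBlock (s x y : ℕ) (0<s : 0 < s) (0<x : 0 < x) (0<y : 0 < y) where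
  open Staircase₂ s x y 0 0<s 0<x 0<y hiding (erdos)

  total≡s+S₂ : total r̄ ≡ s + S₂
  total≡s+S₂ = solve 3 (λ s x y → (s :+ x) :+ ((y :+ con 0) :+ con 0) := s :+ (x :+ y)) refl s x y

  n∸s≡S₂ : total r̄ ∸ s ≡ S₂
  n∸s≡S₂ = trans (cong (_∸ s) total≡s+S₂) (ℕ.m+n∸m≡n s S₂)

  lower-row : ∀ (i : Fin (total r̄)) → (toℕ i <ᵇ R₁) ≡ false → (toℕ i ∸ R₁ <ᵇ R₂) ≡ true
  lower-row i i≮R₁ = ∸-<ᵇ {toℕ i} {R₁} {R₂} (<ᵇ-false⇒≥ i≮R₁)
    (subst (toℕ i <_) (cong (R₁ +_) (ℕ.+-identityʳ R₂)) (Fin.toℕ<n i))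

  right-column : ∀ (j : Fin (total r̄)) → (toℕ j <ᵇ s) ≡ false → (toℕ j ∸ s <ᵇ S₂) ≡ true
  right-column j j≮s = ∸-<ᵇ {toℕ j} {s} {S₂} (<ᵇ-false⇒≥ j≮s)
    (subst (toℕ j <_) total≡s+S₂ (Fin.toℕ<n j))

  Xrsn≗Xrs : ∀ i j → Xrsn R₁ s (total r̄) i j ≡ Xrs r̄ s̄ (total r̄) i j
  Xrsn≗Xrs i j with toℕ i <ᵇ R₁ in i<ᵇR₁ | toℕ j <ᵇ s in j<ᵇs
  ... | true  | true  = sym (trans α₀₀ (÷-cancel 0<s 0<R₁))
  ... | false | true  = refl
  ... | true  | false rewrite right-column j j<ᵇs = begin
    frac (ℤ.+ R₁ ℤ.- ℤ.+ s) (R₁ ℕ.* (total r̄ ∸ s))  ≡⟨ frac-diff {R₁} {s} (R₁ ℕ.* (total r̄ ∸ s)) refl ⟩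
    x ÷ (R₁ ℕ.* (total r̄ ∸ s))                      ≡⟨ cong (λ d → x ÷ (R₁ ℕ.* d)) n∸s≡S₂ ⟩
    x ÷ (R₁ ℕ.* S₂)                                  ≡⟨ α₀₁ ⟨
    α r̄ s̄ 0 1                                        ∎
    where open ≡-Reasoning
  ... | false | false rewrite lower-row i i<ᵇR₁ | right-column j j<ᵇs = begin
    1 ÷ (total r̄ ∸ s)                                ≡⟨ cong (1 ÷_) n∸s≡S₂ ⟩
    1 ÷ S₂
      ≡⟨ ÷-cross 0<S₂ (ℕ.*-mono-≤ 0<R₂ 0<S₂)
                 (solve 2 (λ x y → con 1 :* ((y :+ con 0) :* (x :+ y)) := y :* (x :+ y)) refl x y) ⟩
    y ÷ (R₂ ℕ.* S₂)                                  ≡⟨ α₁₁ ⟨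
    α r̄ s̄ 1 1                                        ∎
    where open ≡-Reasoning

  erdos : Erdos (Xrsn R₁ s (total r̄))
  erdos = Erdos-cong (λ i j → sym (Xrsn≗Xrs i j)) (Staircase₂.erdos s x y 0 0<s 0<x 0<y)

two-block-erdos : (r s n : ℕ) → 0 < s → s < r → r < n → Erdos (Xrsn r s n)
two-block-erdos r s n 0<s s<r r<n with m<n⇒∃[o>0]n≡m+o s<r | m<n⇒∃[o>0]n≡m+o r<n
... | x , 0<x , refl | y , 0<y , refl = subst (λ z → Erdos (Xrsn (s + x) s (s + x + z)))
  (trans (ℕ.+-identityʳ (y + 0)) (ℕ.+-identityʳ y)) (TwoBlock.erdos s x y 0<s 0<x 0<y)

-- Two-by-two block matrices of regular 0/1 matrices

module Quadrants (p a₁ a₂ a₃ a₄ : ℕ) (A₁ A₂ A₃ A₄ : BoolMatrix p)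
                 (0<a₁ : 0 < a₁) (0<a₄ : 0 < a₄) (balanced : a₁ + a₄ ≡ a₂ + a₃)
                 (reg₁ : Regular A₁ a₁) (reg₂ : Regular A₂ a₂)
                 (reg₃ : Regular A₃ a₃) (reg₄ : Regular A₄ a₄) where

  open ℚ-Solver.+-*-Solver using () renaming (solve to ℚ-solve; _:+_ to _⊕_; _:-_ to _⊖_; _:=_ to _≐_)

  D : ℕ
  D = a₁ ℕ.* a₄ + a₂ ℕ.* a₃

  0<D : 0 < D
  0<D = ℕ.≤-trans (ℕ.*-mono-≤ 0<a₁ 0<a₄) (ℕ.m≤m+n (a₁ ℕ.* a₄) (a₂ ℕ.* a₃))

  Quadrant : Set
  Quadrant = Fin p ⊎ Fin p

  level : Quadrant → Quadrant → ℕ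
  level (inj₁ _) (inj₁ _) = a₄
  level (inj₁ _) (inj₂ _) = a₃
  level (inj₂ _) (inj₁ _) = a₂
  level (inj₂ _) (inj₂ _) = a₁

  edge : Quadrant → Quadrant → Bool
  edge (inj₁ i) (inj₁ j) = A₁ i j
  edge (inj₁ i) (inj₂ j) = A₂ i j
  edge (inj₂ i) (inj₁ j) = A₃ i j
  edge (inj₂ i) (inj₂ j) = A₄ i j

  entry : Quadrant → Quadrant → ℚ
  entry x y = (level x y ℕ.* ind (edge x y)) ÷ D

  Xalpha≡entry : ∀ i j → Xalpha p a₁ a₂ a₃ a₄ A₁ A₂ A₃ A₄ i j ≡ entry (splitAt p i) (splitAt p j)
  Xalpha≡entry i j with splitAt p i | splitAt p j
  ... | inj₁ _ | inj₁ _ = refl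
  ... | inj₁ _ | inj₂ _ = refl
  ... | inj₂ _ | inj₁ _ = refl
  ... | inj₂ _ | inj₂ _ = refl

  U V : Quadrant → ℚ
  U (inj₁ _) = 0ℚ
  U (inj₂ _) = a₂ ÷ D ℚ.- a₄ ÷ D
  V (inj₁ _) = a₄ ÷ D
  V (inj₂ _) = a₃ ÷ D

  U+V≡level : ∀ x y → U x ℚ.+ V y ≡ level x y ÷ D
  U+V≡level (inj₁ _) (inj₁ _) = ℚ.+-identityˡ (a₄ ÷ D)
  U+V≡level (inj₁ _) (inj₂ _) = ℚ.+-identityˡ (a₃ ÷ D)
  U+V≡level (inj₂ _) (inj₁ _) = ℚ-solve 2 (λ q₂ q₄ → (q₂ ⊖ q₄) ⊕ q₄ ≐ q₂) refl (a₂ ÷ D) (a₄ ÷ D)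
  U+V≡level (inj₂ _) (inj₂ _) = begin
    a₂ ÷ D ℚ.- a₄ ÷ D ℚ.+ a₃ ÷ D
      ≡⟨ ℚ-solve 3 (λ q₂ q₃ q₄ → (q₂ ⊖ q₄) ⊕ q₃ ≐ (q₂ ⊕ q₃) ⊖ q₄) refl (a₂ ÷ D) (a₃ ÷ D) (a₄ ÷ D) ⟩
    a₂ ÷ D ℚ.+ a₃ ÷ D ℚ.- a₄ ÷ D
      ≡⟨ cong (ℚ._- a₄ ÷ D) balanced÷D ⟨
    a₁ ÷ D ℚ.+ a₄ ÷ D ℚ.- a₄ ÷ D
      ≡⟨ ℚ-solve 2 (λ q₁ q₄ → (q₁ ⊕ q₄) ⊖ q₄ ≐ q₁) refl (a₁ ÷ D) (a₄ ÷ D) ⟩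
    a₁ ÷ D ∎
    where
    open ≡-Reasoning
    balanced÷D : a₁ ÷ D ℚ.+ a₄ ÷ D ≡ a₂ ÷ D ℚ.+ a₃ ÷ D
    balanced÷D = trans (÷-+-same 0<D) (trans (cong (_÷ D) balanced) (sym (÷-+-same 0<D)))

  tight : ∀ x y → entry x y ≡ 0ℚ ⊎ entry x y ≡ U x ℚ.+ V y
  tight x y with edge x y
  ... | true  = inj₂ (trans (cong (_÷ D) (ℕ.*-identityʳ (level x y))) (sym (U+V≡level x y)))
  ... | false = inj₁ (trans (cong (_÷ D) (ℕ.*-zeroʳ (level x y))) (÷-zero D))

  regular-sum : ∀ c (B : Fin p → Bool) {a} → ∑ℕ (λ j → ind (B j)) ≡ a →
                ∑ (λ j → (c ℕ.* ind (B j)) ÷ D) ≡ (c ℕ.* a) ÷ D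
  regular-sum c B deg =
    trans (∑-÷ 0<D (λ j → c ℕ.* ind (B j))) (cong (_÷ D) (trans (∑ℕ-*ˡ c (ind ∘ B)) (cong (c ℕ.*_) deg)))

  ÷D+÷D≡1 : ∀ {m k} → m + k ≡ D → m ÷ D ℚ.+ k ÷ D ≡ 1ℚ
  ÷D+÷D≡1 m+k≡D = trans (÷-+-same 0<D) (trans (cong (_÷ D) m+k≡D) (÷-self 0<D))

  row-sum : ∀ x → ∑ (λ j → entry x (splitAt p j)) ≡ 1ℚ
  row-sum x = trans (∑-splitAt p (entry x)) (halves x)
    where
    halves : ∀ x → ∑ (entry x ∘ inj₁) ℚ.+ ∑ (entry x ∘ inj₂) ≡ 1ℚ
    halves (inj₁ i) =
      trans (cong₂ ℚ._+_ (regular-sum a₄ (A₁ i) (proj₁ reg₁ i)) (regular-sum a₃ (A₂ i) (proj₁ reg₂ i)))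
            (÷D+÷D≡1 (cong₂ _+_ (ℕ.*-comm a₄ a₁) (ℕ.*-comm a₃ a₂)))
    halves (inj₂ i) =
      trans (cong₂ ℚ._+_ (regular-sum a₂ (A₃ i) (proj₁ reg₃ i)) (regular-sum a₁ (A₄ i) (proj₁ reg₄ i)))
            (÷D+÷D≡1 (ℕ.+-comm (a₂ ℕ.* a₃) (a₁ ℕ.* a₄)))

  col-sum : ∀ y → ∑ (λ i → entry (splitAt p i) y) ≡ 1ℚ
  col-sum y = trans (∑-splitAt p (λ x → entry x y)) (halves y)
    where
    halves : ∀ y → ∑ (λ i → entry (inj₁ i) y) ℚ.+ ∑ (λ i → entry (inj₂ i) y) ≡ 1ℚ
    halves (inj₁ j) =
      trans (cong₂ ℚ._+_ (regular-sum a₄ (λ i → A₁ i j) (proj₂ reg₁ j)) (regular-sum a₂ (λ i → A₃ i j) (proj₂ reg₃ j)))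
            (÷D+÷D≡1 (cong (_+ a₂ ℕ.* a₃) (ℕ.*-comm a₄ a₁)))
    halves (inj₂ j) =
      trans (cong₂ ℚ._+_ (regular-sum a₃ (λ i → A₂ i j) (proj₂ reg₂ j)) (regular-sum a₁ (λ i → A₄ i j) (proj₂ reg₄ j)))
            (÷D+÷D≡1 (trans (ℕ.+-comm (a₃ ℕ.* a₂) (a₁ ℕ.* a₄)) (cong (a₁ ℕ.* a₄ +_) (ℕ.*-comm a₃ a₂))))

  erdos : Erdos (Xalpha p a₁ a₂ a₃ a₄ A₁ A₂ A₃ A₄)
  erdos = Erdos-cong (λ i j → sym (Xalpha≡entry i j))
    (erdos-criterion _ certificate (λ i → row-sum (splitAt p i)) (λ j → col-sum (splitAt p j)))
    where
    certificate : DualCertificate (λ i j → entry (splitAt p i) (splitAt p j))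
    certificate = record
      { u = U ∘ splitAt p ; v = V ∘ splitAt p
      ; u+v≥0 = λ i j → subst (0ℚ ℚ.≤_) (sym (U+V≡level (splitAt p i) (splitAt p j))) (÷-nonneg _ D)
      ; tight = λ i j → tight (splitAt p i) (splitAt p j) }

theorem1p4 :
    ((r s : List ℕ) (n : ℕ) → Admissible r s n → Erdos (Xrs r s n)) ×
    ((r s n : ℕ) → 0 < s → s < r → r < n → Erdos (Xrsn r s n)) ×
    ((p a₁ a₂ a₃ a₄ : ℕ) (A₁ A₂ A₃ A₄ : BoolMatrix p) →
       1 ≤ a₁ → a₁ ≤ p → 1 ≤ a₂ → a₂ ≤ p → 1 ≤ a₃ → a₃ ≤ p → 1 ≤ a₄ → a₄ ≤ p →
       a₁ + a₄ ≡ a₂ + a₃ →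
       Regular A₁ a₁ → Regular A₂ a₂ → Regular A₃ a₃ → Regular A₄ a₄ →
       Erdos (Xalpha p a₁ a₂ a₃ a₄ A₁ A₂ A₃ A₄))
theorem1p4 = staircase-erdos , two-block-erdos ,
  λ p a₁ a₂ a₃ a₄ A₁ A₂ A₃ A₄ 0<a₁ _ _ _ _ _ 0<a₄ _ → Quadrants.erdos p a₁ a₂ a₃ a₄ A₁ A₂ A₃ A₄ 0<a₁ 0<a₄
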